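{- Let $k=k(n)$ and $t=t(n)$ be positive integers with $k=\Theta(n)$, $t\le n$, and $t=o(n^{1-\delta})$ for some $\delta>0$. Throw $k$ balls independently and uniformly at random into $n$ bins $B_1,\dots,B_n$; let $M$ be the maximum load over all bins and $M_t$ the maximum load over the first $t$ bins $B_1,\dots,B_t$. Then there is a function $\omega(n)\to\infty$ such that with probability tending to $1$ as $n\to\infty$, $M-M_t\ge\omega(n)$.
   Context: The load of a bin is the number of balls in it. -}

module Defs where

open import Data.Nat using (ℕ; zero; suc; _+_; _*_; _^_; _≤_; _<_; _⊔_; _≤?_; _<?_)
open import Data.Fin using (Fin; toℕ)
open import Data.Fin as F using ()
open import Data.Vec using (Vec; []; _∷_)
open import Data.List using (List; []; _∷_; map; concatMap; length; filter; foldr; allFin)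
open import Data.Product using (Σ; ∃; _×_)
open import Relation.Nullary using (¬_)
open import Relation.Nullary.Decidable using (¬?; yes; no)
open import Data.Fin using (_≟_)

-- All outcomes of throwing k labelled balls into n bins: the vector v
-- gives, for each ball j, the bin (lookup v j) it lands in.  This list
-- has exactly n ^ k entries, each equally likely (uniform measure).
allOutcomes : (n k : ℕ) → List (Vec (Fin n) k)
allOutcomes n zero    = [] ∷ []
allOutcomes n (suc k) =
  concatMap (λ i → map (i ∷_) (allOutcomes n k)) (allFin n)

load : ∀ {n k} → Vec (Fin n) k → Fin n → ℕ
load []       i = 0
load (b ∷ bs) i with b ≟ i
... | yes _ = suc (load bs i)
... | no  _ = load bs i

maxLoad : ∀ {n k} → Vec (Fin n) k → ℕ
maxLoad {n} v = foldr (λ i m → load v i ⊔ m) 0 (allFin n)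

-- maximum load over the first t bins B_1..B_t (bins with index < t)
maxLoadFirst : ∀ {n k} → ℕ → Vec (Fin n) k → ℕ
maxLoadFirst {n} t v = foldr (λ i m → load v i ⊔ m) 0 (filter (λ i → toℕ i <? t) (allFin n))

-- number of outcomes in which M - M_t ≥ w FAILS, i.e. ¬ (w + M_t ≤ M)
badCount : (n k t w : ℕ) → ℕ
badCount n k t w =
  length (filter (λ v → ¬? ((w + maxLoadFirst t v) ≤? maxLoad v)) (allOutcomes n k))

Eventually : (ℕ → Set) → Set
Eventually P = ∃ λ N → ∀ n → N ≤ n → P n

-- Let s be least with s! ≥ n^(1−δ) b^s, so s ~ log n / log log n, and put L = s + ω.
-- If some bin has load exactly L while each of the first t bins has load at most s,
-- then M − M_t ≥ ω.  So a bad outcome either has a first bin with load above s, or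
-- no bin with load L.  By the union bound the first event has probability at most
-- t C(k,s+1) n^−(s+1) ≤ t b^(s+1)/(s+1)!, which is small by the choice of s.
-- For the second, the number X of bins with load L has E X = n C(k,L) (1 − 1/n)^(k−L),
-- and counting pairs of bins exactly gives E X² ≤ E X + (1 + 1/e) (E X)² once
-- 2L(e + 1) ≤ n, so the second moment method gives P(X = 0) ≤ 2/e when E X ≥ e.
-- E X ≥ e holds as long as e 8^b (2a)^L L! ≤ n; ω is chosen so that this holds for
-- every e ≤ ω, and it still tends to infinity because s! is only n^(1−δ+o(1)).

module Submission where

open import Defs
open import Data.Nat using (ℕ; suc; _+_; _*_; _^_; _≤_; _<_; _∸_)
open import Data.Product using (∃; _×_)

open import Data.Nat
open import Data.Nat.Properties
open import Data.Fin as Fin using (Fin; toℕ; punchIn)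
import Data.Fin.Properties as Finₚ
open import Data.Vec using (Vec; []; _∷_)
open import Data.List using (List; []; _∷_; _++_; map; concatMap; length; filter; foldr; allFin; tabulate)
open import Data.List.Membership.Propositional using (_∈_)
open import Data.List.Membership.Propositional.Properties using (∈-allFin)
open import Data.List.Relation.Unary.Any using (here; there)
open import Data.Product using (_,_)
open import Data.Sum using (inj₁; inj₂; [_,_]′)
open import Data.Bool using (if_then_else_)
open import Function using (_∘_; _$_; id)
open import Relation.Nullary using (Dec; does; yes; no; ¬_; contradiction)
open import Relation.Nullary.Decidable using (¬?)
open import Relation.Binary.PropositionalEquality
open import Algebra.Properties.CommutativeSemigroup +-commutativeSemigroup
  using () renaming (interchange to +-interchange)
open import Algebra.Properties.CommutativeSemigroup *-commutativeSemigroup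
  using (x∙yz≈y∙xz; xy∙z≈xz∙y; x∙yz≈xz∙y) renaming (interchange to *-interchange)
open import Algebra.Properties.Semiring.Sum +-*-semiring
  using (sum; sum-syntax; sum-cong-≗; ∑-distrib-+; *-distribˡ-sum; *-distribʳ-sum; sum-remove)
open import Data.Nat.Tactic.RingSolver using (solve-∀)

-- Indicators and finite sums

-- Defined through does, so that 𝟙 (suc a ≟ suc l) and 𝟙 (a ≟ l) agree definitionally.
𝟙 : ∀ {p} {P : Set p} → Dec P → ℕ
𝟙 d = if does d then 1 else 0

module _ {p} {P : Set p} where

  𝟙≤1 : (d : Dec P) → 𝟙 d ≤ 1
  𝟙≤1 (yes _) = ≤-refl
  𝟙≤1 (no _)  = z≤n

  𝟙-yes : (d : Dec P) → P → 𝟙 d ≡ 1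
  𝟙-yes (yes _) _  = refl
  𝟙-yes (no ¬p) p  = contradiction p ¬p

  𝟙-no : (d : Dec P) → ¬ P → 𝟙 d ≡ 0
  𝟙-no (yes p) ¬p = contradiction p ¬p
  𝟙-no (no _)  _  = refl

  𝟙-witness : (d : Dec P) → 1 ≤ 𝟙 d → P
  𝟙-witness (yes p) _ = p

  𝟙≡0⇒¬ : (d : Dec P) → 𝟙 d ≡ 0 → ¬ P
  𝟙≡0⇒¬ (no ¬p) _ = ¬p

  𝟙*𝟙≡𝟙 : (d : Dec P) → 𝟙 d * 𝟙 d ≡ 𝟙 d
  𝟙*𝟙≡𝟙 (yes _) = refl
  𝟙*𝟙≡𝟙 (no _)  = refl

𝟙-⇔ : ∀ {p q} {P : Set p} {Q : Set q} (d : Dec P) (e : Dec Q) → (P → Q) → (Q → P) → 𝟙 d ≡ 𝟙 e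
𝟙-⇔ (yes _) (yes _) _ _ = refl
𝟙-⇔ (yes p) (no ¬q) f _ = contradiction (f p) ¬q
𝟙-⇔ (no ¬p) (yes q) _ g = contradiction (g q) ¬p
𝟙-⇔ (no _)  (no _)  _ _ = refl

∑-const : ∀ n c → (∑[ i < n ] c) ≡ n * c
∑-const zero    c = refl
∑-const (suc n) c = cong (c +_) (∑-const n c)

∑-cong : ∀ n {f g : Fin n → ℕ} → (∀ i → f i ≡ g i) → sum f ≡ sum g
∑-cong n = sum-cong-≗

∑-mono : ∀ n {f g : Fin n → ℕ} → (∀ i → f i ≤ g i) → sum f ≤ sum g
∑-mono zero    f≤g = z≤n
∑-mono (suc n) f≤g = +-mono-≤ (f≤g Fin.zero) (∑-mono n (f≤g ∘ Fin.suc))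

∑-except : ∀ n (i : Fin (suc n)) {f : Fin (suc n) → ℕ} c →
           (∀ j → j ≢ i → f j ≡ c) → sum f ≡ f i + n * c
∑-except n i {f} c f≡c = begin
  sum f                        ≡⟨ sum-remove f ⟩
  f i + sum (f ∘ punchIn i)    ≡⟨ cong (f i +_) (sum-cong-≗ (λ j → f≡c _ (Finₚ.punchInᵢ≢i i j))) ⟩
  f i + (∑[ j < n ] c)         ≡⟨ cong (f i +_) (∑-const n c) ⟩
  f i + n * c                  ∎
  where open ≡-Reasoning

∑-except₂ : ∀ n {i j : Fin (suc (suc n))} → i ≢ j → {f : Fin (suc (suc n)) → ℕ} → ∀ c →
            (∀ b → b ≢ i → b ≢ j → f b ≡ c) → sum f ≡ f i + f j + n * c
∑-except₂ n {i} {j} i≢j {f} c f≡c = begin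
  sum f                                      ≡⟨ sum-remove f ⟩
  f i + sum (f ∘ punchIn i)                  ≡⟨ cong (f i +_) (∑-except n j′ c f∘punchIn≡c) ⟩
  f i + (f (punchIn i j′) + n * c)           ≡⟨ cong (λ b → f i + (f b + n * c)) (Finₚ.punchIn-punchOut i≢j) ⟩
  f i + (f j + n * c)                        ≡⟨ +-assoc (f i) (f j) (n * c) ⟨
  f i + f j + n * c                          ∎
  where
  open ≡-Reasoning
  j′ = Fin.punchOut i≢j
  f∘punchIn≡c : ∀ b → b ≢ j′ → f (punchIn i b) ≡ c
  f∘punchIn≡c b b≢j′ = f≡c _ (Finₚ.punchInᵢ≢i i b) λ eq →
    b≢j′ (Finₚ.punchIn-injective i b j′ (trans eq (sym (Finₚ.punchIn-punchOut i≢j))))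

∑-pos : ∀ n (f : Fin n → ℕ) → 1 ≤ sum f → ∃ λ i → 1 ≤ f i
∑-pos (suc n) f 1≤∑ with f Fin.zero in f0≡
... | suc _ = Fin.zero , ≤-trans (s≤s z≤n) (≤-reflexive (sym f0≡))
... | zero with ∑-pos n (f ∘ Fin.suc) 1≤∑
...   | i , 1≤fi = Fin.suc i , 1≤fi

∑≡0⇒≡0 : ∀ n (f : Fin n → ℕ) → sum f ≡ 0 → ∀ i → f i ≡ 0
∑≡0⇒≡0 (suc n) f eq Fin.zero    = m+n≡0⇒m≡0 (f Fin.zero) eq
∑≡0⇒≡0 (suc n) f eq (Fin.suc i) = ∑≡0⇒≡0 n (f ∘ Fin.suc) (m+n≡0⇒n≡0 (f Fin.zero) eq) i

∑𝟙[toℕ<T]≤T : ∀ n T → (∑[ i < n ] 𝟙 (toℕ i <? T)) ≤ T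
∑𝟙[toℕ<T]≤T zero    T       = z≤n
∑𝟙[toℕ<T]≤T (suc n) zero    =
  ≤-reflexive (trans (∑-cong n (λ i → 𝟙-no (suc (toℕ i) <? 0) λ ())) (trans (∑-const n 0) (*-zeroʳ n)))
∑𝟙[toℕ<T]≤T (suc n) (suc T) = s≤s (≤-trans (≤-reflexive (∑-cong n (λ i →
  𝟙-⇔ (suc (toℕ i) <? suc T) (toℕ i <? T) s≤s⁻¹ s≤s))) (∑𝟙[toℕ<T]≤T n T))

sumOver : ∀ {a} {A : Set a} → List A → (A → ℕ) → ℕ
sumOver []       f = 0
sumOver (x ∷ xs) f = f x + sumOver xs f

infixl 10 sumOver
syntax sumOver xs (λ x → e) = ∑[ x ∈ xs ] e

module _ {a} {A : Set a} where

  ∑∈-cong : ∀ (xs : List A) {f g : A → ℕ} → (∀ x → f x ≡ g x) → sumOver xs f ≡ sumOver xs g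
  ∑∈-cong []       f≡g = refl
  ∑∈-cong (x ∷ xs) f≡g = cong₂ _+_ (f≡g x) (∑∈-cong xs f≡g)

  ∑∈-zero : ∀ (xs : List A) {f : A → ℕ} → (∀ x → f x ≡ 0) → sumOver xs f ≡ 0
  ∑∈-zero []       f≡0 = refl
  ∑∈-zero (x ∷ xs) f≡0 = cong₂ _+_ (f≡0 x) (∑∈-zero xs f≡0)

  ∑∈-mono : ∀ (xs : List A) {f g : A → ℕ} → (∀ x → f x ≤ g x) → sumOver xs f ≤ sumOver xs g
  ∑∈-mono []       f≤g = z≤n
  ∑∈-mono (x ∷ xs) f≤g = +-mono-≤ (f≤g x) (∑∈-mono xs f≤g)

  ∑∈-++ : ∀ (xs ys : List A) f → sumOver (xs ++ ys) f ≡ sumOver xs f + sumOver ys f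
  ∑∈-++ []       ys f = refl
  ∑∈-++ (x ∷ xs) ys f = trans (cong (f x +_) (∑∈-++ xs ys f)) (sym (+-assoc (f x) _ _))

  ∑∈-distrib-+ : ∀ (xs : List A) f g →
                 (∑[ x ∈ xs ] (f x + g x)) ≡ sumOver xs f + sumOver xs g
  ∑∈-distrib-+ []       f g = refl
  ∑∈-distrib-+ (x ∷ xs) f g =
    trans (cong (f x + g x +_) (∑∈-distrib-+ xs f g)) (+-interchange (f x) (g x) _ _)

  *-distribˡ-∑∈ : ∀ (xs : List A) c f → (∑[ x ∈ xs ] (c * f x)) ≡ c * sumOver xs f
  *-distribˡ-∑∈ []       c f = sym (*-zeroʳ c)
  *-distribˡ-∑∈ (x ∷ xs) c f =
    trans (cong (c * f x +_) (*-distribˡ-∑∈ xs c f)) (sym (*-distribˡ-+ c (f x) _))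

  ∑∈-const : ∀ (xs : List A) c → (∑[ x ∈ xs ] c) ≡ length xs * c
  ∑∈-const []       c = refl
  ∑∈-const (x ∷ xs) c = cong (c +_) (∑∈-const xs c)

  ∑∈-comm : ∀ (xs : List A) n (f : A → Fin n → ℕ) →
            (∑[ x ∈ xs ] ∑[ i < n ] f x i) ≡ (∑[ i < n ] ∑[ x ∈ xs ] f x i)
  ∑∈-comm []       n f = sym (trans (∑-const n 0) (*-zeroʳ n))
  ∑∈-comm (x ∷ xs) n f =
    trans (cong (sum (f x) +_) (∑∈-comm xs n f)) (sym (∑-distrib-+ (f x) _))

  length-filter≡∑𝟙 : ∀ {p} {P : A → Set p} (P? : ∀ x → Dec (P x)) xs →
                     length (filter P? xs) ≡ (∑[ x ∈ xs ] 𝟙 (P? x))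
  length-filter≡∑𝟙 P? []       = refl
  length-filter≡∑𝟙 P? (x ∷ xs) with P? x
  ... | yes _ = cong suc (length-filter≡∑𝟙 P? xs)
  ... | no _  = length-filter≡∑𝟙 P? xs

∑∈-map : ∀ {a b} {A : Set a} {B : Set b} (h : A → B) xs f → sumOver (map h xs) f ≡ sumOver xs (f ∘ h)
∑∈-map h []       f = refl
∑∈-map h (x ∷ xs) f = cong (f (h x) +_) (∑∈-map h xs f)

∑∈-concatMap : ∀ {a b} {A : Set a} {B : Set b} (g : A → List B) xs f →
               sumOver (concatMap g xs) f ≡ (∑[ x ∈ xs ] sumOver (g x) f)
∑∈-concatMap g []       f = refl
∑∈-concatMap g (x ∷ xs) f =
  trans (∑∈-++ (g x) (concatMap g xs) f) (cong (sumOver (g x) f +_) (∑∈-concatMap g xs f))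

∑∈-tabulate : ∀ {a} {A : Set a} n (g : Fin n → A) f → sumOver (tabulate g) f ≡ sum (f ∘ g)
∑∈-tabulate zero    g f = refl
∑∈-tabulate (suc n) g f = cong (f (g Fin.zero) +_) (∑∈-tabulate n (g ∘ Fin.suc) f)

∑∈-allFin : ∀ n (f : Fin n → ℕ) → sumOver (allFin n) f ≡ sum f
∑∈-allFin n = ∑∈-tabulate n id

-- Elementary inequalities

^-distribʳ-* : ∀ a b r → (a * b) ^ r ≡ a ^ r * b ^ r
^-distribʳ-* a b zero    = refl
^-distribʳ-* a b (suc r) rewrite ^-distribʳ-* a b r = *-interchange a b (a ^ r) (b ^ r)

^-comm : ∀ x a b → (x ^ a) ^ b ≡ (x ^ b) ^ a
^-comm x a b = trans (^-*-assoc x a b) (trans (cong (x ^_) (*-comm a b)) (sym (^-*-assoc x b a)))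

1≤^ : ∀ {a} n → 1 ≤ a → 1 ≤ a ^ n
1≤^ zero    _   = ≤-refl
1≤^ (suc n) 1≤a = *-mono-≤ 1≤a (1≤^ n 1≤a)

n≤n^p : ∀ n {p} → 1 ≤ p → n ≤ n ^ p
n≤n^p zero    {suc p} _ = z≤n
n≤n^p (suc n) {suc p} _ = m≤m*n (suc n) (suc n ^ p) {{>-nonZero (1≤^ p (s≤s z≤n))}}

n<2^n : ∀ n → n < 2 ^ n
n<2^n zero    = s≤s z≤n
n<2^n (suc n) = +-mono-≤ (1≤^ n (s≤s z≤n)) (≤-trans (n<2^n n) (≤-reflexive (sym (*-identityˡ (2 ^ n)))))

2*a*b≤a*a+b*b : ∀ a b → 2 * a * b ≤ a * a + b * b
2*a*b≤a*a+b*b a b = [ ordered , flipped ]′ (≤-total a b)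
  where
  ordered : ∀ {a b} → a ≤ b → 2 * a * b ≤ a * a + b * b
  ordered {a} a≤b with m≤n⇒∃[o]m+o≡n a≤b
  ... | d , refl = ≤-trans (m≤m+n _ (d * d)) (≤-reflexive (expand a d))
    where
    expand : ∀ a d → 2 * a * (a + d) + d * d ≡ a * a + (a + d) * (a + d)
    expand = solve-∀
  flipped : b ≤ a → 2 * a * b ≤ a * a + b * b
  flipped b≤a = subst₂ _≤_ (xy∙z≈xz∙y 2 b a) (+-comm (b * b) (a * a)) (ordered b≤a)

-- Bernoulli's inequality (1 − 1/(1+x))^j ≥ 1 − j/(1+x), multiplied out so that no subtraction occurs.
bernoulli : ∀ x j → suc x ^ j * suc x ≤ suc x * x ^ j + j * suc x ^ j
bernoulli x zero    = ≤-reflexive (trans (*-identityˡ (suc x)) (sym (trans (+-identityʳ _) (*-identityʳ (suc x)))))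
bernoulli x (suc j) = begin
  suc x * X * suc x                                ≡⟨ split x X ⟩
  (X * suc x) * x + X * suc x                      ≤⟨ +-monoˡ-≤ (X * suc x) (*-monoˡ-≤ x (bernoulli x j)) ⟩
  (suc x * x ^ j + j * X) * x + X * suc x          ≤⟨ m≤m+n _ (j * X) ⟩
  (suc x * x ^ j + j * X) * x + X * suc x + j * X  ≡⟨ collect x (x ^ j) j X ⟩
  suc x * (x * x ^ j) + suc j * (suc x * X)        ∎
  where
  open ≤-Reasoning
  X = suc x ^ j
  split : ∀ x p → (1 + x) * p * (1 + x) ≡ (p * (1 + x)) * x + p * (1 + x)
  split = solve-∀
  collect : ∀ x y j p → ((1 + x) * y + j * p) * x + p * (1 + x) + j * p ≡ (1 + x) * (x * y) + (1 + j) * ((1 + x) * p)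
  collect = solve-∀

bernoulli-ratio : ∀ x j e → (e + 1) * j ≤ suc x → e * suc x ^ j ≤ (e + 1) * x ^ j
bernoulli-ratio x j e h = *-cancelʳ-≤ (e * n ^ j) ((e + 1) * x ^ j) n (+-cancelʳ-≤ (n ^ j * ((e + 1) * j)) _ _ (begin
  e * n ^ j * n + n ^ j * ((e + 1) * j)  ≤⟨ +-monoʳ-≤ (e * n ^ j * n) (*-monoʳ-≤ (n ^ j) h) ⟩
  e * n ^ j * n + n ^ j * n              ≡⟨ collect e (n ^ j) n ⟩
  (e + 1) * (n ^ j * n)                  ≤⟨ *-monoʳ-≤ (e + 1) (bernoulli x j) ⟩
  (e + 1) * (n * x ^ j + j * n ^ j)      ≡⟨ distribute e n (x ^ j) j (n ^ j) ⟩
  (e + 1) * x ^ j * n + n ^ j * ((e + 1) * j) ∎))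
  where
  open ≤-Reasoning
  n = suc x
  collect : ∀ e p n → e * p * n + p * n ≡ (e + 1) * (p * n)
  collect = solve-∀
  distribute : ∀ e n q j p → (e + 1) * (n * q + j * p) ≡ (e + 1) * q * n + p * ((e + 1) * j)
  distribute = solve-∀

[1+x]^j≤2*x^j : ∀ x j → 2 * j ≤ suc x → suc x ^ j ≤ 2 * x ^ j
[1+x]^j≤2*x^j x j h = ≤-trans (≤-reflexive (sym (*-identityˡ (suc x ^ j)))) (bernoulli-ratio x j 1 h)

[1+x]^j≤2^c*x^j : ∀ x c h j → 2 * h ≤ suc x → j ≤ c * h → suc x ^ j ≤ 2 ^ c * x ^ j
[1+x]^j≤2^c*x^j x zero    h zero _  _ = s≤s z≤n
[1+x]^j≤2^c*x^j x (suc c) h j    2h≤ j≤ with j ≤? h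
... | yes j≤h = ≤-trans ([1+x]^j≤2*x^j x j (≤-trans (*-monoʳ-≤ 2 j≤h) 2h≤))
                        (*-monoˡ-≤ (x ^ j) (*-monoʳ-≤ 2 (1≤^ c (s≤s z≤n))))
... | no j≰h with m≤n⇒∃[o]m+o≡n (<⇒≤ (≰⇒> j≰h))
...   | j′ , refl = begin
  suc x ^ (h + j′)                    ≡⟨ ^-distribˡ-+-* (suc x) h j′ ⟩
  suc x ^ h * suc x ^ j′              ≤⟨ *-mono-≤ ([1+x]^j≤2*x^j x h 2h≤) ([1+x]^j≤2^c*x^j x c h j′ 2h≤ (+-cancelˡ-≤ h _ _ j≤)) ⟩
  2 * x ^ h * (2 ^ c * x ^ j′)        ≡⟨ *-interchange 2 (x ^ h) (2 ^ c) (x ^ j′) ⟩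
  2 * 2 ^ c * (x ^ h * x ^ j′)        ≡⟨ cong (2 * 2 ^ c *_) (^-distribˡ-+-* x h j′) ⟨
  2 * 2 ^ c * x ^ (h + j′)            ∎
  where open ≤-Reasoning

[s+w]!≤s!*[s+w]^w : ∀ s w → (s + w) ! ≤ s ! * (s + w) ^ w
[s+w]!≤s!*[s+w]^w s zero    = ≤-reflexive (trans (cong _! (+-identityʳ s)) (sym (*-identityʳ (s !))))
[s+w]!≤s!*[s+w]^w s (suc w) rewrite +-suc s w = begin
  suc (s + w) * (s + w) !                   ≤⟨ *-monoʳ-≤ (suc (s + w)) ([s+w]!≤s!*[s+w]^w s w) ⟩
  suc (s + w) * (s ! * (s + w) ^ w)         ≤⟨ *-monoʳ-≤ (suc (s + w)) (*-monoʳ-≤ (s !) (^-monoˡ-≤ w (n≤1+n (s + w)))) ⟩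
  suc (s + w) * (s ! * suc (s + w) ^ w)     ≡⟨ x∙yz≈y∙xz (suc (s + w)) (s !) _ ⟩
  s ! * (suc (s + w) * suc (s + w) ^ w)     ∎
  where open ≤-Reasoning

2^j*c^[m+j]*m!≤c^m*[m+j]! : ∀ c m j → 2 * c ≤ m → 2 ^ j * c ^ (m + j) * m ! ≤ c ^ m * (m + j) !
2^j*c^[m+j]*m!≤c^m*[m+j]! c m zero    _    rewrite +-identityʳ m = ≤-reflexive (cong (_* m !) (*-identityˡ (c ^ m)))
2^j*c^[m+j]*m!≤c^m*[m+j]! c m (suc j) 2c≤m rewrite +-suc m j = begin
  2 * 2 ^ j * (c * c ^ (m + j)) * m !      ≡⟨ regroup 2 (2 ^ j) c (c ^ (m + j)) (m !) ⟩
  2 * c * (2 ^ j * c ^ (m + j) * m !)      ≤⟨ *-monoʳ-≤ (2 * c) (2^j*c^[m+j]*m!≤c^m*[m+j]! c m j 2c≤m) ⟩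
  2 * c * (c ^ m * (m + j) !)              ≤⟨ *-monoˡ-≤ (c ^ m * (m + j) !) (≤-trans 2c≤m (≤-trans (m≤m+n m j) (n≤1+n _))) ⟩
  suc (m + j) * (c ^ m * (m + j) !)        ≡⟨ x∙yz≈y∙xz (suc (m + j)) (c ^ m) ((m + j) !) ⟩
  c ^ m * (suc (m + j) * (m + j) !)        ∎
  where
  open ≤-Reasoning
  regroup : ∀ a b c d f → a * b * (c * d) * f ≡ (a * c) * (b * d * f)
  regroup = solve-∀

^≤!-eventually : ∀ c → Eventually (λ s → c ^ s ≤ s !)
^≤!-eventually c = m + N , bound
  where
  C = suc c
  m = 2 * C
  N = C ^ m
  instance _ = >-nonZero (1≤^ {C} m (s≤s z≤n))
  bound : ∀ s → m + N ≤ s → c ^ s ≤ s !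
  bound s m+N≤s with m≤n⇒∃[o]m+o≡n (≤-trans (m≤m+n m N) m+N≤s)
  ... | j , refl = ≤-trans (^-monoˡ-≤ (m + j) (n≤1+n c)) (*-cancelˡ-≤ N (begin
    N * C ^ (m + j)               ≤⟨ *-monoˡ-≤ (C ^ (m + j)) (≤-trans (<⇒≤ (n<2^n N)) (^-monoʳ-≤ 2 (+-cancelˡ-≤ m N j m+N≤s))) ⟩
    2 ^ j * C ^ (m + j)           ≡⟨ *-identityʳ _ ⟨
    2 ^ j * C ^ (m + j) * 1       ≤⟨ *-monoʳ-≤ (2 ^ j * C ^ (m + j)) (1≤n! m) ⟩
    2 ^ j * C ^ (m + j) * m !     ≤⟨ 2^j*c^[m+j]*m!≤c^m*[m+j]! C m j ≤-refl ⟩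
    N * (m + j) !                 ∎))
    where open ≤-Reasoning

2*⌊n/2⌋≤n : ∀ n → 2 * ⌊ n /2⌋ ≤ n
2*⌊n/2⌋≤n zero          = z≤n
2*⌊n/2⌋≤n (suc zero)    = z≤n
2*⌊n/2⌋≤n (suc (suc n)) = subst (_≤ suc (suc n)) (sym (*-suc 2 ⌊ n /2⌋)) (s≤s (s≤s (2*⌊n/2⌋≤n n)))

n≤1+2*⌊n/2⌋ : ∀ n → n ≤ suc (2 * ⌊ n /2⌋)
n≤1+2*⌊n/2⌋ zero          = z≤n
n≤1+2*⌊n/2⌋ (suc zero)    = ≤-refl
n≤1+2*⌊n/2⌋ (suc (suc n)) = subst (suc (suc n) ≤_) (cong suc (sym (*-suc 2 ⌊ n /2⌋))) (s≤s (s≤s (n≤1+2*⌊n/2⌋ n)))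

n≤3*⌊n/2⌋ : ∀ n → 2 ≤ n → n ≤ 3 * ⌊ n /2⌋
n≤3*⌊n/2⌋ (suc zero) (s≤s ())
n≤3*⌊n/2⌋ n@(suc (suc m)) _ = begin
  n                           ≤⟨ n≤1+2*⌊n/2⌋ n ⟩
  suc (2 * h)                 ≤⟨ +-monoˡ-≤ (2 * h) (s≤s z≤n) ⟩
  3 * h                       ∎
  where
  open ≤-Reasoning
  h = ⌊ n /2⌋

[1+x]^r≤8^b*x^r : ∀ x b r → 1 ≤ x → r ≤ b * suc x → suc x ^ r ≤ 8 ^ b * x ^ r
[1+x]^r≤8^b*x^r x b r 1≤x r≤bn = subst (λ c → suc x ^ r ≤ c * x ^ r) (sym (^-*-assoc 2 3 b))
  ([1+x]^j≤2^c*x^j x (3 * b) h r (2*⌊n/2⌋≤n (suc x)) (begin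
    r                ≤⟨ r≤bn ⟩
    b * suc x        ≤⟨ *-monoʳ-≤ b (n≤3*⌊n/2⌋ (suc x) (s≤s 1≤x)) ⟩
    b * (3 * h)      ≡⟨ x∙yz≈y∙xz b 3 h ⟩
    3 * (b * h)      ≡⟨ *-assoc 3 b h ⟨
    3 * b * h        ∎))
  where
  open ≤-Reasoning
  h = ⌊ suc x /2⌋

c*l≤c^l*l! : ∀ c l → 1 ≤ c → c * l ≤ c ^ l * l !
c*l≤c^l*l! c zero    _   = ≤-trans (≤-reflexive (*-zeroʳ c)) z≤n
c*l≤c^l*l! c (suc l) 1≤c = *-mono-≤ (subst (_≤ c * c ^ l) (*-identityʳ c) (*-monoʳ-≤ c (1≤^ l 1≤c)))
                                     (subst (_≤ suc l * l !) (*-identityʳ (suc l)) (*-monoʳ-≤ (suc l) (1≤n! l)))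

^-cancelʳ-≤ : ∀ q {a c} → 1 ≤ q → a ^ q ≤ c ^ q → a ≤ c
^-cancelʳ-≤ q@(suc _) {a} {c} _ aᵠ≤cᵠ with a ≤? c
... | yes a≤c = a≤c
... | no a≰c  = contradiction aᵠ≤cᵠ (<⇒≱ (^-monoˡ-< q (≰⇒> a≰c)))

^-cancelʳ-< : ∀ q {a c} → a ^ q < c ^ q → a < c
^-cancelʳ-< q {a} {c} aᵠ<cᵠ with a <? c
... | yes a<c = a<c
... | no a≮c  = contradiction (^-monoˡ-≤ q (≮⇒≥ a≮c)) (<⇒≱ aᵠ<cᵠ)

-- Binomial coefficients

choose : ℕ → ℕ → ℕ
choose _       zero    = 1
choose zero    (suc l) = 0
choose (suc k) (suc l) = choose k l + choose k (suc l)

choose-< : ∀ {k l} → k < l → choose k l ≡ 0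
choose-< {zero}  {suc l} _         = refl
choose-< {suc k} {suc l} (s≤s k<l) = cong₂ _+_ (choose-< k<l) (choose-< (m<n⇒m<1+n k<l))

choose-monoˡ-≤ : ∀ l {k k′} → k ≤ k′ → choose k l ≤ choose k′ l
choose-monoˡ-≤ zero    _          = ≤-refl
choose-monoˡ-≤ (suc l) z≤n        = z≤n
choose-monoˡ-≤ (suc l) (s≤s k≤k′) =
  +-mono-≤ (choose-monoˡ-≤ l k≤k′) (choose-monoˡ-≤ (suc l) k≤k′)

falling : ℕ → ℕ → ℕ
falling k       zero    = 1
falling zero    (suc l) = 0
falling (suc k) (suc l) = suc k * falling k l

falling-suc : ∀ k l → falling k (suc l) + suc l * falling k l ≡ suc k * falling k l
falling-suc zero    zero    = refl
falling-suc zero    (suc l) = *-zeroʳ (suc (suc l))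
falling-suc (suc k) zero    = +-comm (suc k * 1) 1
falling-suc (suc k) (suc l) = begin
  suc k * falling k (suc l) + suc (suc l) * (suc k * falling k l)
    ≡⟨ expand (suc k) (falling k (suc l)) (suc l) (falling k l) ⟩
  suc k * (falling k (suc l) + suc l * falling k l + falling k l)
    ≡⟨ cong (λ z → suc k * (z + falling k l)) (falling-suc k l) ⟩
  suc k * (suc k * falling k l + falling k l)
    ≡⟨ collect (suc k) (falling k l) ⟩
  suc (suc k) * (suc k * falling k l) ∎
  where
  open ≡-Reasoning
  expand : ∀ a b c d → a * b + (1 + c) * (a * d) ≡ a * (b + c * d + d)
  expand = solve-∀
  collect : ∀ a b → a * (a * b + b) ≡ (1 + a) * (a * b)
  collect = solve-∀

choose*!≡falling : ∀ k l → choose k l * l ! ≡ falling k l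
choose*!≡falling k       zero    = refl
choose*!≡falling zero    (suc l) = refl
choose*!≡falling (suc k) (suc l) = begin
  (choose k l + choose k (suc l)) * (suc l * l !)
    ≡⟨ distribute (choose k l) (choose k (suc l)) (suc l) (l !) ⟩
  choose k (suc l) * (suc l * l !) + suc l * (choose k l * l !)
    ≡⟨ cong₂ (λ a b → a + suc l * b) (choose*!≡falling k (suc l)) (choose*!≡falling k l) ⟩
  falling k (suc l) + suc l * falling k l
    ≡⟨ falling-suc k l ⟩
  suc k * falling k l ∎
  where
  open ≡-Reasoning
  distribute : ∀ a b c d → (a + b) * (c * d) ≡ b * (c * d) + c * (a * d)
  distribute = solve-∀

falling≤^ : ∀ k l → falling k l ≤ k ^ l
falling≤^ k       zero    = ≤-refl
falling≤^ zero    (suc l) = z≤n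
falling≤^ (suc k) (suc l) = *-monoʳ-≤ (suc k) (≤-trans (falling≤^ k l) (^-monoˡ-≤ l (n≤1+n k)))

^≤falling : ∀ r l → suc r ^ l ≤ falling (r + l) l
^≤falling r zero    = ≤-refl
^≤falling r (suc l) rewrite +-suc r l = *-mono-≤ (s≤s (m≤m+n r l)) (^≤falling r l)

choose*-∸-suc : ∀ k l (f : ℕ → ℕ) → choose k (suc l) * f (suc (k ∸ suc l)) ≡ choose k (suc l) * f (k ∸ l)
choose*-∸-suc k l f with l <? k
... | yes l<k = cong (λ r → choose k (suc l) * f r) (sym (+-∸-assoc 1 l<k))
... | no l≮k  rewrite choose-< (s≤s (≮⇒≥ l≮k)) = refl

binomialTerm : ℕ → ℕ → ℕ → ℕ
binomialTerm x k l = choose k l * x ^ (k ∸ l)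

binomialTerm⁻ : ℕ → ℕ → ℕ → ℕ
binomialTerm⁻ x k zero    = 0
binomialTerm⁻ x k (suc l) = binomialTerm x k l

binomialTerm-suc : ∀ x k l → binomialTerm x (suc k) l ≡ binomialTerm⁻ x k l + x * binomialTerm x k l
binomialTerm-suc x k zero    = trans (*-identityˡ (x ^ suc k)) (cong (x *_) (sym (*-identityˡ (x ^ k))))
binomialTerm-suc x k (suc l) = begin
  (choose k l + choose k (suc l)) * x ^ (k ∸ l)              ≡⟨ *-distribʳ-+ (x ^ (k ∸ l)) (choose k l) _ ⟩
  binomialTerm x k l + choose k (suc l) * x ^ (k ∸ l)        ≡⟨ cong (binomialTerm x k l +_) (choose*-∸-suc k l (x ^_)) ⟨
  binomialTerm x k l + choose k (suc l) * (x * x ^ (k ∸ suc l)) ≡⟨ cong (binomialTerm x k l +_) (x∙yz≈y∙xz (choose k (suc l)) x _) ⟩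
  binomialTerm x k l + x * binomialTerm x k (suc l)          ∎
  where open ≡-Reasoning

binomialTerm*!≤ : ∀ x b K σ → K ≤ b * x → binomialTerm x K σ * σ ! ≤ b ^ σ * x ^ K
binomialTerm*!≤ x b K σ K≤bx with σ ≤? K
... | no σ≰K rewrite choose-< (≰⇒> σ≰K) = z≤n
... | yes σ≤K with m≤n⇒∃[o]m+o≡n σ≤K
...   | r , refl rewrite m+n∸m≡n σ r = begin
  choose (σ + r) σ * x ^ r * σ !     ≡⟨ xy∙z≈xz∙y (choose (σ + r) σ) (x ^ r) (σ !) ⟩
  choose (σ + r) σ * σ ! * x ^ r     ≡⟨ cong (_* x ^ r) (choose*!≡falling (σ + r) σ) ⟩
  falling (σ + r) σ * x ^ r          ≤⟨ *-monoˡ-≤ (x ^ r) (falling≤^ (σ + r) σ) ⟩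
  (σ + r) ^ σ * x ^ r                ≤⟨ *-monoˡ-≤ (x ^ r) (^-monoˡ-≤ σ K≤bx) ⟩
  (b * x) ^ σ * x ^ r                ≡⟨ cong (_* x ^ r) (^-distribʳ-* b x σ) ⟩
  b ^ σ * x ^ σ * x ^ r              ≡⟨ *-assoc (b ^ σ) (x ^ σ) (x ^ r) ⟩
  b ^ σ * (x ^ σ * x ^ r)            ≡⟨ cong (b ^ σ *_) (^-distribˡ-+-* x σ r) ⟨
  b ^ σ * x ^ (σ + r)                ∎
  where open ≤-Reasoning

-- Counting outcomes by the loads of one or two bins

module _ (n : ℕ) where

  ∑Ω-suc : ∀ k (f : Vec (Fin n) (suc k) → ℕ) →
           (∑[ v ∈ allOutcomes n (suc k) ] f v) ≡ (∑[ b < n ] ∑[ v ∈ allOutcomes n k ] f (b ∷ v))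
  ∑Ω-suc k f = begin
    sumOver (allOutcomes n (suc k)) f                          ≡⟨ ∑∈-concatMap _ (allFin n) f ⟩
    (∑[ b ∈ allFin n ] sumOver (map (b ∷_) (allOutcomes n k)) f) ≡⟨ ∑∈-cong (allFin n) (λ b → ∑∈-map (b ∷_) (allOutcomes n k) f) ⟩
    (∑[ b ∈ allFin n ] ∑[ v ∈ allOutcomes n k ] f (b ∷ v))     ≡⟨ ∑∈-allFin n _ ⟩
    (∑[ b < n ] ∑[ v ∈ allOutcomes n k ] f (b ∷ v))            ∎
    where open ≡-Reasoning

  ∑Ω-1 : ∀ k → (∑[ v ∈ allOutcomes n k ] 1) ≡ n ^ k
  ∑Ω-1 zero    = refl
  ∑Ω-1 (suc k) = trans (∑Ω-suc k _) (trans (∑-cong n {g = λ _ → n ^ k} (λ _ → ∑Ω-1 k)) (∑-const n (n ^ k)))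

  length-allOutcomes : ∀ k → length (allOutcomes n k) ≡ n ^ k
  length-allOutcomes k = trans (sym (trans (∑∈-const (allOutcomes n k) 1) (*-identityʳ _))) (∑Ω-1 k)

module _ {n k} (b i : Fin n) (v : Vec (Fin n) k) where

  load-∷-≡ : b ≡ i → load (b ∷ v) i ≡ suc (load v i)
  load-∷-≡ b≡i with b Fin.≟ i
  ... | yes _  = refl
  ... | no b≢i = contradiction b≡i b≢i

  load-∷-≢ : b ≢ i → load (b ∷ v) i ≡ load v i
  load-∷-≢ b≢i with b Fin.≟ i
  ... | yes b≡i = contradiction b≡i b≢i
  ... | no _    = refl

module _ (x : ℕ) (i : Fin (suc x)) where

  private
    Ω = allOutcomes (suc x)

  ∑Ω-load-suc : ∀ k (f : ℕ → ℕ) →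
    (∑[ v ∈ Ω (suc k) ] f (load v i)) ≡ (∑[ v ∈ Ω k ] f (suc (load v i))) + x * (∑[ v ∈ Ω k ] f (load v i))
  ∑Ω-load-suc k f = begin
    (∑[ v ∈ Ω (suc k) ] f (load v i))                    ≡⟨ ∑Ω-suc (suc x) k (λ v → f (load v i)) ⟩
    (∑[ b < suc x ] ∑[ v ∈ Ω k ] f (load (b ∷ v) i))     ≡⟨ ∑-except x i S other≡ ⟩
    (∑[ v ∈ Ω k ] f (load (i ∷ v) i)) + x * S            ≡⟨ cong (_+ x * S) (∑∈-cong (Ω k) (λ v → cong f (load-∷-≡ i i v refl))) ⟩
    (∑[ v ∈ Ω k ] f (suc (load v i))) + x * S            ∎
    where
    open ≡-Reasoning
    S = ∑[ v ∈ Ω k ] f (load v i)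
    other≡ : ∀ b → b ≢ i → (∑[ v ∈ Ω k ] f (load (b ∷ v) i)) ≡ S
    other≡ b b≢i = ∑∈-cong (Ω k) (λ v → cong f (load-∷-≢ b i v b≢i))

  #load≡ : ∀ k l → (∑[ v ∈ Ω k ] 𝟙 (load v i ≟ l)) ≡ binomialTerm x k l
  #load≡ zero    zero    = refl
  #load≡ zero    (suc l) = refl
  #load≡ (suc k) l       = begin
    (∑[ v ∈ Ω (suc k) ] 𝟙 (load v i ≟ l))                                        ≡⟨ ∑Ω-load-suc k (λ a → 𝟙 (a ≟ l)) ⟩
    (∑[ v ∈ Ω k ] 𝟙 (suc (load v i) ≟ l)) + x * (∑[ v ∈ Ω k ] 𝟙 (load v i ≟ l)) ≡⟨ cong₂ (λ a b → a + x * b) (shifted l) (#load≡ k l) ⟩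
    binomialTerm⁻ x k l + x * binomialTerm x k l                                  ≡⟨ binomialTerm-suc x k l ⟨
    binomialTerm x (suc k) l                                                      ∎
    where
    open ≡-Reasoning
    shifted : ∀ l → (∑[ v ∈ Ω k ] 𝟙 (suc (load v i) ≟ l)) ≡ binomialTerm⁻ x k l
    shifted zero    = ∑∈-zero (Ω k) (λ _ → refl)
    shifted (suc l) = #load≡ k l

  #load≥ : ∀ k s → (∑[ v ∈ Ω k ] 𝟙 (s ≤? load v i)) ≤ binomialTerm (suc x) k s
  #load≥ k       zero    = ≤-reflexive (trans (∑∈-cong (Ω k) (λ v → 𝟙-yes (0 ≤? load v i) z≤n))
                                        (trans (∑Ω-1 (suc x) k) (sym (*-identityˡ _))))
  #load≥ zero    (suc s) = z≤n
  #load≥ (suc k) (suc s) = begin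
    (∑[ v ∈ Ω (suc k) ] 𝟙 (suc s ≤? load v i))                      ≡⟨ ∑Ω-load-suc k (λ a → 𝟙 (suc s ≤? a)) ⟩
    (∑[ v ∈ Ω k ] 𝟙 (suc s ≤? suc (load v i))) + x * S              ≡⟨ cong (_+ x * S) (∑∈-cong (Ω k) (λ v →
                                                                         𝟙-⇔ (suc s ≤? suc (load v i)) (s ≤? load v i) s≤s⁻¹ s≤s)) ⟩
    (∑[ v ∈ Ω k ] 𝟙 (s ≤? load v i)) + x * S                        ≤⟨ +-mono-≤ (#load≥ k s) (*-mono-≤ (n≤1+n x) (#load≥ k (suc s))) ⟩
    binomialTerm (suc x) k s + suc x * binomialTerm (suc x) k (suc s) ≡⟨ binomialTerm-suc (suc x) k (suc s) ⟨
    binomialTerm (suc x) (suc k) (suc s)                            ∎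
    where
    open ≤-Reasoning
    S = ∑[ v ∈ Ω k ] 𝟙 (suc s ≤? load v i)

module _ (y : ℕ) {i j : Fin (suc (suc y))} (i≢j : i ≢ j) where

  private
    Ω = allOutcomes (suc (suc y))

  ∑Ω-load₂-suc : ∀ k (g : ℕ → ℕ → ℕ) →
    (∑[ v ∈ Ω (suc k) ] g (load v i) (load v j)) ≡
      (∑[ v ∈ Ω k ] g (suc (load v i)) (load v j)) + (∑[ v ∈ Ω k ] g (load v i) (suc (load v j)))
      + y * (∑[ v ∈ Ω k ] g (load v i) (load v j))
  ∑Ω-load₂-suc k g = begin
    (∑[ v ∈ Ω (suc k) ] g (load v i) (load v j))                         ≡⟨ ∑Ω-suc (suc (suc y)) k (λ v → g (load v i) (load v j)) ⟩
    (∑[ b < suc (suc y) ] ∑[ v ∈ Ω k ] g (load (b ∷ v) i) (load (b ∷ v) j)) ≡⟨ ∑-except₂ y i≢j S other≡ ⟩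
    (∑[ v ∈ Ω k ] g (load (i ∷ v) i) (load (i ∷ v) j))
      + (∑[ v ∈ Ω k ] g (load (j ∷ v) i) (load (j ∷ v) j)) + y * S        ≡⟨ cong₂ (λ a b → a + b + y * S) at-i at-j ⟩
    (∑[ v ∈ Ω k ] g (suc (load v i)) (load v j))
      + (∑[ v ∈ Ω k ] g (load v i) (suc (load v j))) + y * S              ∎
    where
    open ≡-Reasoning
    S = ∑[ v ∈ Ω k ] g (load v i) (load v j)
    at-i : (∑[ v ∈ Ω k ] g (load (i ∷ v) i) (load (i ∷ v) j)) ≡ (∑[ v ∈ Ω k ] g (suc (load v i)) (load v j))
    at-i = ∑∈-cong (Ω k) (λ v → cong₂ g (load-∷-≡ i i v refl) (load-∷-≢ i j v i≢j))
    at-j : (∑[ v ∈ Ω k ] g (load (j ∷ v) i) (load (j ∷ v) j)) ≡ (∑[ v ∈ Ω k ] g (load v i) (suc (load v j)))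
    at-j = ∑∈-cong (Ω k) (λ v → cong₂ g (load-∷-≢ j i v (i≢j ∘ sym)) (load-∷-≡ j j v refl))
    other≡ : ∀ b → b ≢ i → b ≢ j →
      (∑[ v ∈ Ω k ] g (load (b ∷ v) i) (load (b ∷ v) j)) ≡ S
    other≡ b b≢i b≢j = ∑∈-cong (Ω k) (λ v → cong₂ g (load-∷-≢ b i v b≢i) (load-∷-≢ b j v b≢j))

  #load₂≡ : ∀ k l₁ l₂ → (∑[ v ∈ Ω k ] (𝟙 (load v i ≟ l₁) * 𝟙 (load v j ≟ l₂))) ≡ choose k l₁ * binomialTerm y (k ∸ l₁) l₂
  #load₂≡ zero    zero     zero     = refl
  #load₂≡ zero    zero     (suc l₂) = refl
  #load₂≡ zero    (suc l₁) l₂       = refl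
  #load₂≡ (suc k) l₁       l₂       = trans (∑Ω-load₂-suc k (λ a b → 𝟙 (a ≟ l₁) * 𝟙 (b ≟ l₂))) (step l₁)
    where
    open ≡-Reasoning
    shiftedⱼ : ∀ l₁ l₂ → (∑[ v ∈ Ω k ] (𝟙 (load v i ≟ l₁) * 𝟙 (suc (load v j) ≟ l₂))) ≡ choose k l₁ * binomialTerm⁻ y (k ∸ l₁) l₂
    shiftedⱼ l₁ zero     = trans (∑∈-zero (Ω k) (λ v → *-zeroʳ (𝟙 (load v i ≟ l₁)))) (sym (*-zeroʳ (choose k l₁)))
    shiftedⱼ l₁ (suc l₂) = #load₂≡ k l₁ l₂
    step : ∀ l₁ → (∑[ v ∈ Ω k ] (𝟙 (suc (load v i) ≟ l₁) * 𝟙 (load v j ≟ l₂))) + (∑[ v ∈ Ω k ] (𝟙 (load v i ≟ l₁) * 𝟙 (suc (load v j) ≟ l₂)))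
                  + y * (∑[ v ∈ Ω k ] (𝟙 (load v i ≟ l₁) * 𝟙 (load v j ≟ l₂))) ≡ choose (suc k) l₁ * binomialTerm y (suc k ∸ l₁) l₂
    cong₃ : ∀ {a a′ b b′ d d′} → a ≡ a′ → b ≡ b′ → d ≡ d′ → a + b + y * d ≡ a′ + b′ + y * d′
    cong₃ refl refl refl = refl
    step zero = trans (cong₃ (∑∈-zero (Ω k) (λ _ → refl)) (shiftedⱼ 0 l₂) (#load₂≡ k 0 l₂)) $ begin
      1 * binomialTerm⁻ y k l₂ + y * (1 * binomialTerm y k l₂) ≡⟨ cong₂ (λ a b → a + y * b) (*-identityˡ _) (*-identityˡ _) ⟩
      binomialTerm⁻ y k l₂ + y * binomialTerm y k l₂    ≡⟨ binomialTerm-suc y k l₂ ⟨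
      binomialTerm y (suc k) l₂                         ≡⟨ *-identityˡ _ ⟨
      1 * binomialTerm y (suc k) l₂                     ∎
    step (suc l) = trans (cong₃ (#load₂≡ k l l₂) (shiftedⱼ (suc l) l₂) (#load₂≡ k (suc l) l₂)) $ begin
      A + c * bt⁻ + y * (c * bt)                        ≡⟨ factor A c bt⁻ y bt ⟩
      A + c * (bt⁻ + y * bt)                            ≡⟨ cong (λ t → A + c * t) (binomialTerm-suc y (k ∸ suc l) l₂) ⟨
      A + c * binomialTerm y (suc (k ∸ suc l)) l₂       ≡⟨ cong (A +_) (choose*-∸-suc k l (λ r → binomialTerm y r l₂)) ⟩
      A + c * binomialTerm y (k ∸ l) l₂                 ≡⟨ *-distribʳ-+ (binomialTerm y (k ∸ l) l₂) (choose k l) c ⟨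
      choose (suc k) (suc l) * binomialTerm y (k ∸ l) l₂ ∎
      where
      A   = choose k l * binomialTerm y (k ∸ l) l₂
      c   = choose k (suc l)
      bt⁻ = binomialTerm⁻ y (k ∸ suc l) l₂
      bt  = binomialTerm y (k ∸ suc l) l₂
      factor : ∀ a c d y e → a + c * d + y * (c * e) ≡ a + c * (d + y * e)
      factor = solve-∀

-- The second moment method

module _ {a} {A : Set a} (xs : List A) (f : A → ℕ) where

  private
    T₁ = ∑[ x ∈ xs ] f x
    T₂ = ∑[ x ∈ xs ] (f x * f x)
    #pos  = ∑[ x ∈ xs ] 𝟙 (1 ≤? f x)
    #zero = ∑[ x ∈ xs ] 𝟙 (f x ≟ 0)

  #zero+#pos≡length : #zero + #pos ≡ length xs
  #zero+#pos≡length = begin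
    #zero + #pos                                ≡⟨ ∑∈-distrib-+ xs (λ x → 𝟙 (f x ≟ 0)) (λ x → 𝟙 (1 ≤? f x)) ⟨
    (∑[ x ∈ xs ] (𝟙 (f x ≟ 0) + 𝟙 (1 ≤? f x)))  ≡⟨ ∑∈-cong xs (λ x → zero-or-pos (f x)) ⟩
    (∑[ x ∈ xs ] 1)                             ≡⟨ ∑∈-const xs 1 ⟩
    length xs * 1                               ≡⟨ *-identityʳ _ ⟩
    length xs                                   ∎
    where
    open ≡-Reasoning
    zero-or-pos : ∀ m → 𝟙 (m ≟ 0) + 𝟙 (1 ≤? m) ≡ 1
    zero-or-pos zero    = refl
    zero-or-pos (suc _) = refl

  T₁≤T₂ : T₁ ≤ T₂
  T₁≤T₂ = ∑∈-mono xs (λ x → m≤m*m (f x))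
    where
    m≤m*m : ∀ m → m ≤ m * m
    m≤m*m zero    = z≤n
    m≤m*m (suc m) = m≤m*n (suc m) (suc m)

  #zero≤length : #zero ≤ length xs
  #zero≤length = ≤-trans (m≤m+n #zero #pos) (≤-reflexive #zero+#pos≡length)

  #pos≤length : #pos ≤ length xs
  #pos≤length = ≤-trans (m≤n+m #pos #zero) (≤-reflexive #zero+#pos≡length)

  -- Sum the AM-GM inequality 2 T₁ T₂ f ≤ T₁² f² + T₂² [f ≥ 1] over xs.
  cauchy-schwarz : T₁ * T₁ ≤ T₂ * #pos
  cauchy-schwarz with T₂ in T₂≡
  ... | zero  rewrite n≤0⇒n≡0 (≤-trans T₁≤T₂ (≤-reflexive T₂≡)) = z≤n
  ... | suc t = *-cancelˡ-≤ (suc t) (+-cancelˡ-≤ (suc t * (T₁ * T₁)) _ _ (begin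
    suc t * (T₁ * T₁) + suc t * (T₁ * T₁)     ≡⟨ double T₁ (suc t) ⟩
    2 * T₁ * suc t * T₁                        ≡⟨ *-distribˡ-∑∈ xs (2 * T₁ * suc t) f ⟨
    (∑[ x ∈ xs ] (2 * T₁ * suc t * f x))       ≤⟨ ∑∈-mono xs (λ x → weighted-amgm T₁ (suc t) (f x)) ⟩
    (∑[ x ∈ xs ] (T₁ * T₁ * (f x * f x) + suc t * suc t * 𝟙 (1 ≤? f x)))
      ≡⟨ ∑∈-distrib-+ xs (λ x → T₁ * T₁ * (f x * f x)) (λ x → suc t * suc t * 𝟙 (1 ≤? f x)) ⟩
    (∑[ x ∈ xs ] (T₁ * T₁ * (f x * f x))) + (∑[ x ∈ xs ] (suc t * suc t * 𝟙 (1 ≤? f x)))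
                                               ≡⟨ cong₂ _+_ (*-distribˡ-∑∈ xs (T₁ * T₁) (λ x → f x * f x)) (*-distribˡ-∑∈ xs (suc t * suc t) _) ⟩
    T₁ * T₁ * T₂ + suc t * suc t * #pos        ≡⟨ cong (λ z → T₁ * T₁ * z + suc t * suc t * #pos) T₂≡ ⟩
    T₁ * T₁ * suc t + suc t * suc t * #pos     ≡⟨ regroup (T₁ * T₁) (suc t) #pos ⟩
    suc t * (T₁ * T₁) + suc t * (suc t * #pos) ∎))
    where
    open ≤-Reasoning
    double : ∀ a b → b * (a * a) + b * (a * a) ≡ 2 * a * b * a
    double = solve-∀
    regroup : ∀ a b p → a * b + b * b * p ≡ b * a + b * (b * p)
    regroup = solve-∀
    weighted-amgm : ∀ α β m → 2 * α * β * m ≤ α * α * (m * m) + β * β * 𝟙 (1 ≤? m)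
    weighted-amgm α β zero    = ≤-trans (≤-reflexive (*-zeroʳ (2 * α * β))) z≤n
    weighted-amgm α β (suc m) = subst₂ _≤_ (reassoc α β (suc m)) (square α β (suc m)) (2*a*b≤a*a+b*b (α * suc m) β)
      where
      reassoc : ∀ α β m → 2 * (α * m) * β ≡ 2 * α * β * m
      reassoc = solve-∀
      square : ∀ α β m → α * m * (α * m) + β * β ≡ α * α * (m * m) + β * β * 1
      square = solve-∀

  second-moment-method : ∀ e → e * length xs ≤ T₁ → e * length xs * T₂ ≤ (e + 2) * (T₁ * T₁) →
                         e * #zero ≤ 2 * length xs
  second-moment-method e eN≤T₁ eNT₂≤ with T₂ in T₂≡
  ... | zero  = ≤-trans (*-monoʳ-≤ e #zero≤length) (≤-trans eN≤T₁ (≤-trans T₁≤T₂ (≤-trans (≤-reflexive T₂≡) z≤n)))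
  ... | suc t = ≤-trans (+-cancelʳ-≤ (e * #pos) (e * #zero) (2 * #pos) (begin
    e * #zero + e * #pos    ≡⟨ *-distribˡ-+ e #zero #pos ⟨
    e * (#zero + #pos)      ≡⟨ cong (e *_) #zero+#pos≡length ⟩
    e * length xs           ≤⟨ eN≤[e+2]#pos ⟩
    (e + 2) * #pos          ≡⟨ *-distribʳ-+ #pos e 2 ⟩
    e * #pos + 2 * #pos     ≡⟨ +-comm (e * #pos) (2 * #pos) ⟩
    2 * #pos + e * #pos     ∎)) (*-monoʳ-≤ 2 #pos≤length)
    where
    open ≤-Reasoning
    eN≤[e+2]#pos : e * length xs ≤ (e + 2) * #pos
    eN≤[e+2]#pos = *-cancelʳ-≤ (e * length xs) ((e + 2) * #pos) (suc t) (begin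
      e * length xs * suc t        ≤⟨ eNT₂≤ ⟩
      (e + 2) * (T₁ * T₁)          ≤⟨ *-monoʳ-≤ (e + 2) cauchy-schwarz ⟩
      (e + 2) * (T₂ * #pos)        ≡⟨ cong (λ z → (e + 2) * (z * #pos)) T₂≡ ⟩
      (e + 2) * (suc t * #pos)     ≡⟨ x∙yz≈xz∙y (e + 2) (suc t) #pos ⟩
      (e + 2) * #pos * suc t       ∎)

binsWithLoad : ∀ {n k} → ℕ → Vec (Fin n) k → ℕ
binsWithLoad {n} L v = ∑[ i < n ] 𝟙 (load v i ≟ L)

∑Ω-binsWithLoad : ∀ x K L → (∑[ v ∈ allOutcomes (suc x) K ] binsWithLoad L v) ≡ suc x * binomialTerm x K L
∑Ω-binsWithLoad x K L = begin
  (∑[ v ∈ allOutcomes (suc x) K ] binsWithLoad L v)                  ≡⟨ ∑∈-comm (allOutcomes (suc x) K) (suc x) (λ v i → 𝟙 (load v i ≟ L)) ⟩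
  (∑[ i < suc x ] ∑[ v ∈ allOutcomes (suc x) K ] 𝟙 (load v i ≟ L)) ≡⟨ ∑-cong (suc x) (λ i → #load≡ x i K L) ⟩
  (∑[ i < suc x ] binomialTerm x K L)         ≡⟨ ∑-const (suc x) _ ⟩
  suc x * binomialTerm x K L                  ∎
  where open ≡-Reasoning

module _ (y K L : ℕ) where

  private
    n = suc (suc y)
    Ω = allOutcomes n K
    E = binomialTerm (suc y) K L
    G = choose K L * (choose K L * y ^ (K ∸ L ∸ L))
    pair : Fin n → Fin n → Vec (Fin n) K → ℕ
    pair i j v = 𝟙 (load v i ≟ L) * 𝟙 (load v j ≟ L)

  #pair≤ : ∀ i j → (∑[ v ∈ Ω ] pair i j v) ≤ 𝟙 (j Fin.≟ i) * E + G
  #pair≤ i j with j Fin.≟ i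
  ... | yes refl = begin
    (∑[ v ∈ Ω ] pair i i v)           ≡⟨ ∑∈-cong Ω (λ v → 𝟙*𝟙≡𝟙 (load v i ≟ L)) ⟩
    (∑[ v ∈ Ω ] 𝟙 (load v i ≟ L))     ≡⟨ #load≡ (suc y) i K L ⟩
    E                                 ≡⟨ *-identityˡ E ⟨
    1 * E                             ≤⟨ m≤m+n (1 * E) G ⟩
    1 * E + G                         ∎
    where open ≤-Reasoning
  ... | no j≢i = begin
    (∑[ v ∈ Ω ] pair i j v)                       ≡⟨ #load₂≡ y (j≢i ∘ sym) K L L ⟩
    choose K L * (choose (K ∸ L) L * y ^ (K ∸ L ∸ L)) ≤⟨ *-monoʳ-≤ (choose K L) (*-monoˡ-≤ (y ^ (K ∸ L ∸ L)) (choose-monoˡ-≤ L (m∸n≤m K L))) ⟩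
    G                                             ∎
    where open ≤-Reasoning

  ∑Ω-binsWithLoad² : (∑[ v ∈ Ω ] (binsWithLoad L v * binsWithLoad L v)) ≤ n * (E + n * G)
  ∑Ω-binsWithLoad² = begin
    (∑[ v ∈ Ω ] (binsWithLoad L v * binsWithLoad L v))  ≡⟨ ∑∈-cong Ω square ⟩
    (∑[ v ∈ Ω ] ∑[ i < n ] ∑[ j < n ] pair i j v)       ≡⟨ ∑∈-comm Ω n (λ v i → ∑[ j < n ] pair i j v) ⟩
    (∑[ i < n ] ∑[ v ∈ Ω ] ∑[ j < n ] pair i j v)       ≡⟨ ∑-cong n (λ i → ∑∈-comm Ω n (λ v j → pair i j v)) ⟩
    (∑[ i < n ] ∑[ j < n ] ∑[ v ∈ Ω ] pair i j v)       ≤⟨ ∑-mono n (λ i → ∑-mono n (#pair≤ i)) ⟩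
    (∑[ i < n ] ∑[ j < n ] (𝟙 (j Fin.≟ i) * E + G))     ≡⟨ ∑-cong n row ⟩
    (∑[ i < n ] (E + n * G))                            ≡⟨ ∑-const n (E + n * G) ⟩
    n * (E + n * G)                                     ∎
    where
    open ≤-Reasoning
    square : ∀ v → binsWithLoad L v * binsWithLoad L v ≡ (∑[ i < n ] ∑[ j < n ] pair i j v)
    square v = trans (*-distribʳ-sum (binsWithLoad L v) (λ i → 𝟙 (load v i ≟ L)))
                     (∑-cong n (λ i → *-distribˡ-sum (𝟙 (load v i ≟ L)) (λ j → 𝟙 (load v j ≟ L))))
    row : ∀ i → (∑[ j < n ] (𝟙 (j Fin.≟ i) * E + G)) ≡ E + n * G
    row i = begin-equality
      (∑[ j < n ] (𝟙 (j Fin.≟ i) * E + G))       ≡⟨ ∑-except (suc y) i G (λ j j≢i → cong (λ b → b * E + G) (𝟙-no (j Fin.≟ i) j≢i)) ⟩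
      𝟙 (i Fin.≟ i) * E + G + suc y * G          ≡⟨ cong (λ b → b * E + G + suc y * G) (𝟙-yes (i Fin.≟ i) refl) ⟩
      1 * E + G + suc y * G                      ≡⟨ collect E G y ⟩
      E + n * G                                  ∎
      where
      collect : ∀ e g y → 1 * e + g + (1 + y) * g ≡ e + (2 + y) * g
      collect = solve-∀

  #noBinWithLoad≤ : ∀ e → e * n ^ K ≤ n * E → e * n ^ K * G ≤ (e + 1) * (E * E) →
                    e * (∑[ v ∈ Ω ] 𝟙 (binsWithLoad L v ≟ 0)) ≤ 2 * n ^ K
  #noBinWithLoad≤ e eN≤nE eNG≤ = subst (λ N → e * #zero ≤ 2 * N) (length-allOutcomes n K)
    (second-moment-method Ω (binsWithLoad L) e
      (subst₂ (λ N T → e * N ≤ T) (sym (length-allOutcomes n K)) (sym T₁≡) eN≤nE)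
      (subst (λ N → e * N * T₂ ≤ (e + 2) * (T₁ * T₁)) (sym (length-allOutcomes n K)) eNT₂≤))
    where
    #zero = ∑[ v ∈ Ω ] 𝟙 (binsWithLoad L v ≟ 0)
    T₁ = ∑[ v ∈ Ω ] binsWithLoad L v
    T₂ = ∑[ v ∈ Ω ] (binsWithLoad L v * binsWithLoad L v)
    T₁≡ : T₁ ≡ n * E
    T₁≡ = ∑Ω-binsWithLoad (suc y) K L
    N = n ^ K
    eNT₂≤ : e * N * T₂ ≤ (e + 2) * (T₁ * T₁)
    eNT₂≤ = begin
      e * N * T₂                                    ≤⟨ *-monoʳ-≤ (e * N) ∑Ω-binsWithLoad² ⟩
      e * N * (n * (E + n * G))                     ≡⟨ expand e N n E G ⟩
      n * E * (e * N) + n * n * (e * N * G)         ≤⟨ +-mono-≤ (*-monoʳ-≤ (n * E) eN≤nE) (*-monoʳ-≤ (n * n) eNG≤) ⟩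
      n * E * (n * E) + n * n * ((e + 1) * (E * E)) ≡⟨ collect e n E ⟩
      (e + 2) * ((n * E) * (n * E))                 ≡⟨ cong (λ z → (e + 2) * (z * z)) T₁≡ ⟨
      (e + 2) * (T₁ * T₁)                           ∎
      where
      open ≤-Reasoning
      expand : ∀ e N n E G → e * N * (n * (E + n * G)) ≡ n * E * (e * N) + n * n * (e * N * G)
      expand = solve-∀
      collect : ∀ e n E → n * E * (n * E) + n * n * ((e + 1) * (E * E)) ≡ (e + 2) * ((n * E) * (n * E))
      collect = solve-∀

-- Bad outcomes

module _ {a} {A : Set a} (f : A → ℕ) where

  foldr-⊔-upper : ∀ {x} xs → x ∈ xs → f x ≤ foldr (λ y m → f y ⊔ m) 0 xs
  foldr-⊔-upper (y ∷ xs) (here refl) = m≤m⊔n (f y) _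
  foldr-⊔-upper (y ∷ xs) (there x∈)  = ≤-trans (foldr-⊔-upper xs x∈) (m≤n⊔m (f y) _)

  foldr-⊔-filter-lub : ∀ {p} {P : A → Set p} (P? : ∀ x → Dec (P x)) {c} xs →
                       (∀ x → P x → f x ≤ c) → foldr (λ y m → f y ⊔ m) 0 (filter P? xs) ≤ c
  foldr-⊔-filter-lub P? []       bound = z≤n
  foldr-⊔-filter-lub P? (x ∷ xs) bound with P? x
  ... | yes px = ⊔-lub (bound x px) (foldr-⊔-filter-lub P? xs bound)
  ... | no _   = foldr-⊔-filter-lub P? xs bound

module _ {n k} (v : Vec (Fin n) k) where

  load≤maxLoad : ∀ i → load v i ≤ maxLoad v
  load≤maxLoad i = foldr-⊔-upper (load v) (allFin n) (∈-allFin i)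

  maxLoadFirst≤ : ∀ {T s} → (∀ i → toℕ i < T → load v i ≤ s) → maxLoadFirst T v ≤ s
  maxLoadFirst≤ {T} = foldr-⊔-filter-lub (load v) (λ i → toℕ i <? T) (allFin n)

  gap-≥ : ∀ {T s w} → 1 ≤ binsWithLoad (s + w) v → (∀ i → toℕ i < T → load v i ≤ s) →
          w + maxLoadFirst T v ≤ maxLoad v
  gap-≥ {T} {s} {w} 1≤X low with ∑-pos n (λ i → 𝟙 (load v i ≟ (s + w))) 1≤X
  ... | i , 1≤𝟙 = begin
    w + maxLoadFirst T v  ≤⟨ +-monoʳ-≤ w (maxLoadFirst≤ low) ⟩
    w + s                 ≡⟨ +-comm w s ⟩
    s + w                 ≡⟨ 𝟙-witness (load v i ≟ (s + w)) 1≤𝟙 ⟨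
    load v i              ≤⟨ load≤maxLoad i ⟩
    maxLoad v             ∎
    where open ≤-Reasoning

firstBinsAbove : ∀ {n k} → ℕ → ℕ → Vec (Fin n) k → ℕ
firstBinsAbove {n} T s v = ∑[ i < n ] (𝟙 (toℕ i <? T) * 𝟙 (suc s ≤? load v i))

module _ {n k} (T s w : ℕ) (v : Vec (Fin n) k) where

  private
    bad? = ¬? (w + maxLoadFirst T v ≤? maxLoad v)

  𝟙[bad]≤ : 𝟙 bad? ≤ 𝟙 (binsWithLoad (s + w) v ≟ 0) + firstBinsAbove T s v
  𝟙[bad]≤ with binsWithLoad (s + w) v in X≡ | firstBinsAbove T s v in Y≡
  ... | zero  | _     = ≤-trans (𝟙≤1 bad?) (m≤m+n 1 _)
  ... | suc _ | suc _ = ≤-trans (𝟙≤1 bad?) (s≤s z≤n)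
  ... | suc _ | zero  = ≤-reflexive (𝟙-no bad? (λ bad → bad (gap-≥ v (≤-trans (s≤s z≤n) (≤-reflexive (sym X≡))) low)))
    where
    low : ∀ i → toℕ i < T → load v i ≤ s
    low i i<T = ≮⇒≥ (𝟙≡0⇒¬ (suc s ≤? load v i) (begin-equality
      𝟙 (suc s ≤? load v i)                         ≡⟨ *-identityˡ _ ⟨
      1 * 𝟙 (suc s ≤? load v i)                     ≡⟨ cong (_* 𝟙 (suc s ≤? load v i)) (𝟙-yes (toℕ i <? T) i<T) ⟨
      𝟙 (toℕ i <? T) * 𝟙 (suc s ≤? load v i)        ≡⟨ ∑≡0⇒≡0 n _ Y≡ i ⟩
      0                                             ∎))
      where open ≤-Reasoning

badCount≤ : ∀ n K T s w → badCount n K T w ≤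
  (∑[ v ∈ allOutcomes n K ] 𝟙 (binsWithLoad (s + w) v ≟ 0)) + (∑[ v ∈ allOutcomes n K ] firstBinsAbove T s v)
badCount≤ n K T s w = begin
  badCount n K T w                                           ≡⟨ length-filter≡∑𝟙 _ Ω ⟩
  (∑[ v ∈ Ω ] 𝟙 (¬? (w + maxLoadFirst T v ≤? maxLoad v)))    ≤⟨ ∑∈-mono Ω (𝟙[bad]≤ T s w) ⟩
  (∑[ v ∈ Ω ] (𝟙 (binsWithLoad (s + w) v ≟ 0) + firstBinsAbove T s v))
                                                             ≡⟨ ∑∈-distrib-+ Ω (λ v → 𝟙 (binsWithLoad (s + w) v ≟ 0)) (firstBinsAbove T s) ⟩
  (∑[ v ∈ Ω ] 𝟙 (binsWithLoad (s + w) v ≟ 0)) + (∑[ v ∈ Ω ] firstBinsAbove T s v) ∎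
  where
  open ≤-Reasoning
  Ω = allOutcomes n K

∑Ω-firstBinsAbove≤ : ∀ x K T s → (∑[ v ∈ allOutcomes (suc x) K ] firstBinsAbove T s v) ≤ T * binomialTerm (suc x) K (suc s)
∑Ω-firstBinsAbove≤ x K T s = begin
  (∑[ v ∈ Ω ] firstBinsAbove T s v)                                      ≡⟨ ∑∈-comm Ω n (λ v i → 𝟙 (toℕ i <? T) * 𝟙 (suc s ≤? load v i)) ⟩
  (∑[ i < n ] ∑[ v ∈ Ω ] (𝟙 (toℕ i <? T) * 𝟙 (suc s ≤? load v i)))      ≡⟨ ∑-cong n (λ i → *-distribˡ-∑∈ Ω (𝟙 (toℕ i <? T)) (λ v → 𝟙 (suc s ≤? load v i))) ⟩
  (∑[ i < n ] (𝟙 (toℕ i <? T) * ∑[ v ∈ Ω ] 𝟙 (suc s ≤? load v i)))      ≤⟨ ∑-mono n (λ i → *-monoʳ-≤ (𝟙 (toℕ i <? T)) (#load≥ x i K (suc s))) ⟩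
  (∑[ i < n ] (𝟙 (toℕ i <? T) * B))                                      ≡⟨ *-distribʳ-sum {n} B (λ i → 𝟙 (toℕ i <? T)) ⟨
  (∑[ i < n ] 𝟙 (toℕ i <? T)) * B                                        ≤⟨ *-monoˡ-≤ B (∑𝟙[toℕ<T]≤T n T) ⟩
  T * B                                                                  ∎
  where
  open ≤-Reasoning
  n = suc x
  Ω = allOutcomes n K
  B = binomialTerm (suc x) K (suc s)

-- Bounded search

least : {P : ℕ → Set} → (∀ n → Dec (P n)) → ℕ → ℕ
least P? zero    = 0
least P? (suc N) with P? 0
... | yes _ = 0
... | no _  = suc (least (P? ∘ suc) N)

least-minimal : {P : ℕ → Set} (P? : ∀ n → Dec (P n)) → ∀ N {σ} → σ < least P? N → ¬ P σ
least-minimal P? (suc N) {σ} σ< with P? 0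
least-minimal P? (suc N) {zero}   σ<         | no ¬P0 = ¬P0
least-minimal P? (suc N) {suc σ}  (s≤s σ<)   | no _   = least-minimal (P? ∘ suc) N σ<

least-correct : {P : ℕ → Set} (P? : ∀ n → Dec (P n)) → ∀ N → P N → P (least P? N)
least-correct P? zero    PN = PN
least-correct P? (suc N) PN with P? 0
... | yes P0 = P0
... | no _   = least-correct (P? ∘ suc) N PN

greatest : {P : ℕ → Set} → (∀ n → Dec (P n)) → ℕ → ℕ
greatest P? zero    = 0
greatest P? (suc N) with P? (suc N)
... | yes _ = suc N
... | no _  = greatest P? N

greatest-maximal : {P : ℕ → Set} (P? : ∀ n → Dec (P n)) → ∀ N {w} → w ≤ N → P w → w ≤ greatest P? N
greatest-maximal P? zero    w≤N Pw = w≤N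
greatest-maximal P? (suc N) w≤N Pw with P? (suc N)
... | yes _   = w≤N
... | no ¬PN with m≤n⇒m<n∨m≡n w≤N
...   | inj₁ w<N  = greatest-maximal P? N (s≤s⁻¹ w<N) Pw
...   | inj₂ refl = contradiction Pw ¬PN

greatest-correct : {P : ℕ → Set} (P? : ∀ n → Dec (P n)) → ∀ N → 1 ≤ greatest P? N → P (greatest P? N)
greatest-correct P? (suc N) 1≤g with P? (suc N)
... | yes PN = PN
... | no _   = greatest-correct P? N 1≤g

-- The bound for a fixed number of bins

2*m*[T*binomialTerm]≤x^K : ∀ x K T s m b → K ≤ b * x → 2 * m * T * b ^ suc s ≤ suc s ! →
  2 * m * (T * binomialTerm x K (suc s)) ≤ x ^ K
2*m*[T*binomialTerm]≤x^K x K T s m b K≤bx c = *-cancelʳ-≤ _ _ (σ !) {{σ !≢0}} (begin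
  2 * m * (T * binomialTerm x K σ) * σ !     ≡⟨ regroup (2 * m) T (binomialTerm x K σ) (σ !) ⟩
  2 * m * T * (binomialTerm x K σ * σ !)     ≤⟨ *-monoʳ-≤ (2 * m * T) (binomialTerm*!≤ x b K σ K≤bx) ⟩
  2 * m * T * (b ^ σ * x ^ K)                ≡⟨ *-assoc (2 * m * T) (b ^ σ) (x ^ K) ⟨
  2 * m * T * b ^ σ * x ^ K                  ≤⟨ *-monoˡ-≤ (x ^ K) c ⟩
  σ ! * x ^ K                                ≡⟨ *-comm (σ !) (x ^ K) ⟩
  x ^ K * σ !                                ∎)
  where
  open ≤-Reasoning
  σ = suc s
  regroup : ∀ a t c f → a * (t * c) * f ≡ a * t * (c * f)
  regroup = solve-∀

module _ (y K a b e L : ℕ) (1≤a : 1 ≤ a) (1≤b : 1 ≤ b) (1≤e : 1 ≤ e)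
         (K≤bn : K ≤ b * suc (suc y)) (n≤aK : suc (suc y) ≤ a * K)
         (small : e * 8 ^ b * ((2 * a) ^ L * L !) ≤ suc (suc y)) where

  private
    n = suc (suc y)
    x = suc y
    Q = (2 * a) ^ L * L !
    E = binomialTerm x K L
    G = choose K L * (choose K L * y ^ (K ∸ L ∸ L))
    open ≤-Reasoning

    a*[m+m]≡2*a*m : ∀ a m → a * (m + m) ≡ 2 * a * m
    a*[m+m]≡2*a*m = solve-∀

    2aL≤Q : 2 * a * L ≤ Q
    2aL≤Q = c*l≤c^l*l! (2 * a) L (≤-trans 1≤a (m≤m+n a _))

    Q≤n : Q ≤ n
    Q≤n = ≤-trans (m≤n*m Q (e * 8 ^ b) {{>-nonZero (*-mono-≤ 1≤e (1≤^ b (s≤s z≤n)))}}) small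

    L+L≤K : L + L ≤ K
    L+L≤K = *-cancelˡ-≤ a {{>-nonZero 1≤a}} (begin
      a * (L + L)   ≡⟨ a*[m+m]≡2*a*m a L ⟩
      2 * a * L     ≤⟨ 2aL≤Q ⟩
      Q             ≤⟨ Q≤n ⟩
      n             ≤⟨ n≤aK ⟩
      a * K         ∎)

    [e+1]*[L+L]≤n : (e + 1) * (L + L) ≤ n
    [e+1]*[L+L]≤n = begin
      (e + 1) * (L + L)      ≤⟨ *-monoˡ-≤ (L + L) (+-monoʳ-≤ e 1≤e) ⟩
      (e + e) * (L + L)      ≡⟨ regroup e L ⟩
      e * (2 * (2 * 1 * L))  ≤⟨ *-monoʳ-≤ e (*-monoʳ-≤ 2 (*-monoˡ-≤ L (*-monoʳ-≤ 2 1≤a))) ⟩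
      e * (2 * (2 * a * L))  ≤⟨ *-monoʳ-≤ e (*-mono-≤ (≤-trans (s≤s (s≤s z≤n)) (n≤n^p 8 1≤b)) 2aL≤Q) ⟩
      e * (8 ^ b * Q)        ≡⟨ *-assoc e (8 ^ b) Q ⟨
      e * 8 ^ b * Q          ≤⟨ small ⟩
      n                      ∎
      where
      regroup : ∀ e L → (e + e) * (L + L) ≡ e * (2 * (2 * 1 * L))
      regroup = solve-∀

    r = K ∸ L
    L+r≡K : L + r ≡ K
    L+r≡K = m+[n∸m]≡n (≤-trans (m≤m+n L L) L+L≤K)
    L≤r : L ≤ r
    L≤r = +-cancelˡ-≤ L L r (≤-trans L+L≤K (≤-reflexive (sym L+r≡K)))

    n^L≤ : n ^ L ≤ (2 * a) ^ L * (choose K L * L !)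
    n^L≤ = begin
      n ^ L                                ≤⟨ ^-monoˡ-≤ L n≤2a[1+r] ⟩
      (2 * a * suc r) ^ L                  ≡⟨ ^-distribʳ-* (2 * a) (suc r) L ⟩
      (2 * a) ^ L * suc r ^ L              ≤⟨ *-monoʳ-≤ ((2 * a) ^ L) (^≤falling r L) ⟩
      (2 * a) ^ L * falling (r + L) L      ≡⟨ cong (λ k → (2 * a) ^ L * falling k L) (trans (+-comm r L) L+r≡K) ⟩
      (2 * a) ^ L * falling K L            ≡⟨ cong ((2 * a) ^ L *_) (choose*!≡falling K L) ⟨
      (2 * a) ^ L * (choose K L * L !)     ∎
      where
      n≤2a[1+r] : n ≤ 2 * a * suc r
      n≤2a[1+r] = begin
        n                  ≤⟨ n≤aK ⟩
        a * K              ≡⟨ cong (a *_) L+r≡K ⟨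
        a * (L + r)        ≤⟨ *-monoʳ-≤ a (+-mono-≤ (≤-trans L≤r (n≤1+n r)) (n≤1+n r)) ⟩
        a * (suc r + suc r) ≡⟨ a*[m+m]≡2*a*m a (suc r) ⟩
        2 * a * suc r      ∎

  eN≤nE : e * n ^ K ≤ n * E
  eN≤nE = begin
    e * n ^ K                                           ≡⟨ cong (λ k → e * n ^ k) L+r≡K ⟨
    e * n ^ (L + r)                                     ≡⟨ cong (e *_) (^-distribˡ-+-* n L r) ⟩
    e * (n ^ L * n ^ r)                                 ≤⟨ *-monoʳ-≤ e (*-mono-≤ n^L≤ ([1+x]^r≤8^b*x^r x b r (s≤s z≤n) (≤-trans (m∸n≤m K L) K≤bn))) ⟩
    e * ((2 * a) ^ L * (choose K L * L !) * (8 ^ b * x ^ r)) ≡⟨ regroup e ((2 * a) ^ L) (choose K L) (L !) (8 ^ b) (x ^ r) ⟩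
    e * 8 ^ b * Q * E                                   ≤⟨ *-monoˡ-≤ E small ⟩
    n * E                                               ∎
    where
    regroup : ∀ e p c f g q → e * (p * (c * f) * (g * q)) ≡ e * g * (p * f) * (c * q)
    regroup = solve-∀

  private
    r₂ = K ∸ L ∸ L
    L+r₂≡r : L + r₂ ≡ r
    L+r₂≡r = m+[n∸m]≡n L≤r
    x^L*x^r₂≡x^r : x ^ L * x ^ r₂ ≡ x ^ r
    x^L*x^r₂≡x^r = trans (sym (^-distribˡ-+-* x L r₂)) (cong (x ^_) L+r₂≡r)
    n*y≤x*x : n * y ≤ x * x
    n*y≤x*x = ≤-trans (m≤m+n (n * y) 1) (≤-reflexive (square y))
      where
      square : ∀ y → (2 + y) * y + 1 ≡ (1 + y) * (1 + y)
      square = solve-∀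

  eNG≤[e+1]E² : e * n ^ K * G ≤ (e + 1) * (E * E)
  eNG≤[e+1]E² = begin
    e * n ^ K * G                                           ≡⟨ cong (λ k → e * n ^ k * G) K≡ ⟨
    e * n ^ (L + L + r₂) * (C * (C * y ^ r₂))                ≡⟨ cong (λ z → e * z * (C * (C * y ^ r₂))) (^-distribˡ-+-* n (L + L) r₂) ⟩
    e * (n ^ (L + L) * n ^ r₂) * (C * (C * y ^ r₂))          ≡⟨ regroup e (n ^ (L + L)) (n ^ r₂) C (y ^ r₂) ⟩
    C * C * ((e * n ^ (L + L)) * (n ^ r₂ * y ^ r₂))          ≤⟨ *-monoʳ-≤ (C * C) (*-mono-≤ (bernoulli-ratio x (L + L) e [e+1]*[L+L]≤n) n^r₂*y^r₂≤) ⟩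
    C * C * ((e + 1) * x ^ (L + L) * (x ^ r₂ * x ^ r₂))      ≡⟨ cong (λ z → C * C * ((e + 1) * z * (x ^ r₂ * x ^ r₂))) (^-distribˡ-+-* x L L) ⟩
    C * C * ((e + 1) * (x ^ L * x ^ L) * (x ^ r₂ * x ^ r₂))  ≡⟨ square C (e + 1) (x ^ L) (x ^ r₂) ⟩
    (e + 1) * ((C * (x ^ L * x ^ r₂)) * (C * (x ^ L * x ^ r₂))) ≡⟨ cong (λ z → (e + 1) * ((C * z) * (C * z))) x^L*x^r₂≡x^r ⟩
    (e + 1) * (E * E)                                       ∎
    where
    C = choose K L
    K≡ : L + L + r₂ ≡ K
    K≡ = trans (+-assoc L L r₂) (trans (cong (L +_) L+r₂≡r) L+r≡K)
    n^r₂*y^r₂≤ : n ^ r₂ * y ^ r₂ ≤ x ^ r₂ * x ^ r₂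
    n^r₂*y^r₂≤ = begin
      n ^ r₂ * y ^ r₂     ≡⟨ ^-distribʳ-* n y r₂ ⟨
      (n * y) ^ r₂        ≤⟨ ^-monoˡ-≤ r₂ n*y≤x*x ⟩
      (x * x) ^ r₂        ≡⟨ ^-distribʳ-* x x r₂ ⟩
      x ^ r₂ * x ^ r₂     ∎
    regroup : ∀ e p q c t → e * (p * q) * (c * (c * t)) ≡ c * c * ((e * p) * (q * t))
    regroup = solve-∀
    square : ∀ c f p q → c * c * (f * (p * p) * (q * q)) ≡ f * ((c * (p * q)) * (c * (p * q)))
    square = solve-∀

  #noBinWithLoad-small : e * (∑[ v ∈ allOutcomes n K ] 𝟙 (binsWithLoad L v ≟ 0)) ≤ 2 * n ^ K
  #noBinWithLoad-small = #noBinWithLoad≤ y K L e eN≤nE eNG≤[e+1]E²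

m*badCount≤ : ∀ y K T s w m a b → 1 ≤ m → 1 ≤ a → 1 ≤ b →
  K ≤ b * suc (suc y) → suc (suc y) ≤ a * K →
  4 * m * 8 ^ b * ((2 * a) ^ (s + w) * (s + w) !) ≤ suc (suc y) →
  2 * m * T * b ^ suc s ≤ suc s ! →
  m * badCount (suc (suc y)) K T w ≤ suc (suc y) ^ K
m*badCount≤ y K T s w m a b 1≤m 1≤a 1≤b K≤bn n≤aK small few = *-cancelˡ-≤ 2 (begin
  2 * (m * badCount n K T w)                  ≡⟨ *-assoc 2 m _ ⟨
  2 * m * badCount n K T w                    ≤⟨ *-monoʳ-≤ (2 * m) (badCount≤ n K T s w) ⟩
  2 * m * (Z + Y)                             ≡⟨ *-distribˡ-+ (2 * m) Z Y ⟩
  2 * m * Z + 2 * m * Y                       ≤⟨ +-mono-≤ 2mZ≤ (*-monoʳ-≤ (2 * m) (∑Ω-firstBinsAbove≤ (suc y) K T s)) ⟩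
  n ^ K + 2 * m * (T * binomialTerm n K (suc s)) ≤⟨ +-monoʳ-≤ (n ^ K) (2*m*[T*binomialTerm]≤x^K n K T s m b K≤bn few) ⟩
  n ^ K + n ^ K                               ≡⟨ cong (n ^ K +_) (+-identityʳ (n ^ K)) ⟨
  2 * n ^ K                                   ∎)
  where
  open ≤-Reasoning
  n = suc (suc y)
  Z = ∑[ v ∈ allOutcomes n K ] 𝟙 (binsWithLoad (s + w) v ≟ 0)
  Y = ∑[ v ∈ allOutcomes n K ] firstBinsAbove T s v
  2mZ≤ : 2 * m * Z ≤ n ^ K
  2mZ≤ = *-cancelˡ-≤ 2 (subst (_≤ 2 * n ^ K) (regroup m Z)
           (#noBinWithLoad-small y K a b (4 * m) (s + w) 1≤a 1≤b (≤-trans 1≤m (m≤n*m m 4)) K≤bn n≤aK small))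
    where
    regroup : ∀ m z → 4 * m * z ≡ 2 * (2 * m * z)
    regroup = solve-∀

-- Asymptotics

module _ {P Q : ℕ → Set} where

  eventually-× : Eventually P → Eventually Q → Eventually (λ n → P n × Q n)
  eventually-× (N , P≥N) (M , Q≥M) = N ⊔ M , λ n N⊔M≤n → P≥N n (m⊔n≤o⇒m≤o N M N⊔M≤n) , Q≥M n (m⊔n≤o⇒n≤o N M N⊔M≤n)

  eventually-mono : (∀ n → P n → Q n) → Eventually P → Eventually Q
  eventually-mono P⇒Q (N , P≥N) = N , λ n N≤n → P⇒Q n (P≥N n N≤n)

module Choice (a b p q : ℕ) (1≤a : 1 ≤ a) (1≤b : 1 ≤ b) (1≤p : 1 ≤ p) (p<q : p < q) where

  private
    1≤q : 1 ≤ q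
    1≤q = ≤-trans 1≤p (<⇒≤ p<q)

  -- σ! ≥ n^(1−δ) b^σ for δ = p/q, raised to the q-th power.
  Enough : ℕ → ℕ → Set
  Enough n σ = n ^ (q ∸ p) * (b ^ σ) ^ q ≤ (σ !) ^ q

  enough? : ∀ n σ → Dec (Enough n σ)
  enough? n σ = _ ≤? _

  -- Grows like log n / log log n.
  threshold : ℕ → ℕ
  threshold n = least (enough? n ∘ suc) n

  threshold!< : ∀ n → 2 ≤ n → (threshold n !) ^ q < n ^ (q ∸ p) * (b ^ threshold n) ^ q
  threshold!< n 2≤n = ≰⇒> (not-enough (threshold n) ≤-refl)
    where
    not-enough : ∀ t → t ≤ threshold n → ¬ Enough n t
    not-enough zero    _    enough = <⇒≱ 2≤n (begin
      n                         ≤⟨ n≤n^p n (m<n⇒0<n∸m p<q) ⟩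
      n ^ (q ∸ p)               ≡⟨ *-identityʳ _ ⟨
      n ^ (q ∸ p) * 1           ≡⟨ cong (n ^ (q ∸ p) *_) (^-zeroˡ q) ⟨
      n ^ (q ∸ p) * (b ^ 0) ^ q ≤⟨ enough ⟩
      1 ^ q                     ≡⟨ ^-zeroˡ q ⟩
      1                         ∎)
      where open ≤-Reasoning
    not-enough (suc t) t<s = least-minimal (enough? n ∘ suc) n t<s

  threshold!<n*b^t : ∀ n → 2 ≤ n → threshold n ! < n * b ^ threshold n
  threshold!<n*b^t n 2≤n = ^-cancelʳ-< q (begin-strict
    (t !) ^ q                    <⟨ threshold!< n 2≤n ⟩
    n ^ (q ∸ p) * (b ^ t) ^ q    ≤⟨ *-monoˡ-≤ ((b ^ t) ^ q) (^-monoʳ-≤ n {{>-nonZero (≤-trans (s≤s z≤n) 2≤n)}} (m∸n≤m q p)) ⟩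
    n ^ q * (b ^ t) ^ q          ≡⟨ ^-distribʳ-* n (b ^ t) q ⟨
    (n * b ^ t) ^ q              ∎)
    where
    open ≤-Reasoning
    t = threshold n

  enough-eventually : Eventually (λ n → Enough n (suc n))
  enough-eventually with ^≤!-eventually (2 * b)
  ... | N , [2b]^σ≤σ! = N , λ n N≤n → enough n ([2b]^σ≤σ! (suc n) (≤-trans N≤n (n≤1+n n)))
    where
    enough : ∀ n → (2 * b) ^ suc n ≤ suc n ! → Enough n (suc n)
    enough n [2b]^σ≤σ! = begin
      n ^ (q ∸ p) * (b ^ σ) ^ q    ≤⟨ *-monoˡ-≤ ((b ^ σ) ^ q) (≤-trans (^-monoˡ-≤ (q ∸ p) (n≤1+n n)) (^-monoʳ-≤ σ (m∸n≤m q p))) ⟩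
      σ ^ q * (b ^ σ) ^ q          ≡⟨ ^-distribʳ-* σ (b ^ σ) q ⟨
      (σ * b ^ σ) ^ q              ≤⟨ ^-monoˡ-≤ q (*-monoˡ-≤ (b ^ σ) (<⇒≤ (n<2^n σ))) ⟩
      (2 ^ σ * b ^ σ) ^ q          ≡⟨ cong (_^ q) (^-distribʳ-* 2 b σ) ⟨
      ((2 * b) ^ σ) ^ q            ≤⟨ ^-monoˡ-≤ q [2b]^σ≤σ! ⟩
      (σ !) ^ q                    ∎
      where
      open ≤-Reasoning
      σ = suc n

  few-high-first-bins : ∀ n m T → (2 * m * T) ^ q ≤ n ^ (q ∸ p) → Enough n (suc n) →
                        2 * m * T * b ^ suc (threshold n) ≤ suc (threshold n) !
  few-high-first-bins n m T [2mT]^q≤ enough = ^-cancelʳ-≤ q 1≤q (begin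
    (2 * m * T * b ^ σ) ^ q          ≡⟨ ^-distribʳ-* (2 * m * T) (b ^ σ) q ⟩
    (2 * m * T) ^ q * (b ^ σ) ^ q    ≤⟨ *-monoˡ-≤ ((b ^ σ) ^ q) [2mT]^q≤ ⟩
    n ^ (q ∸ p) * (b ^ σ) ^ q        ≤⟨ least-correct (enough? n ∘ suc) n enough ⟩
    (σ !) ^ q                        ∎)
    where
    open ≤-Reasoning
    σ = suc (threshold n)

  -- W s w ≥ 8^b (2a)^(s+w) b^s (s+w)! / s!, and s!/b^s < n^(1−δ) for s = threshold n.
  W : ℕ → ℕ → ℕ
  W s w = 8 ^ b * ((2 * a) ^ (s + w) * (s + w) ^ w) * b ^ s

  fits? : ∀ n w → Dec ((w * W (threshold n) w) ^ q ≤ n ^ p)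
  fits? n w = _ ≤? _

  gap : ℕ → ℕ
  gap n = greatest (fits? n) n

  gap-fits : ∀ n e → 2 ≤ n → 1 ≤ e → e ≤ gap n →
             e * 8 ^ b * ((2 * a) ^ (threshold n + gap n) * (threshold n + gap n) !) ≤ n
  gap-fits n e 2≤n 1≤e e≤w = ^-cancelʳ-≤ q 1≤q (begin
    (e * 8 ^ b * ((2 * a) ^ L * L !)) ^ q                  ≤⟨ ^-monoˡ-≤ q (*-monoʳ-≤ (e * 8 ^ b) (*-monoʳ-≤ ((2 * a) ^ L) ([s+w]!≤s!*[s+w]^w s w))) ⟩
    (e * 8 ^ b * ((2 * a) ^ L * (s ! * (s + w) ^ w))) ^ q   ≡⟨ cong (_^ q) (regroup e (8 ^ b) ((2 * a) ^ L) (s !) ((s + w) ^ w)) ⟩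
    (e * V * s !) ^ q                                      ≡⟨ ^-distribʳ-* (e * V) (s !) q ⟩
    (e * V) ^ q * (s !) ^ q                                ≤⟨ *-monoʳ-≤ ((e * V) ^ q) (<⇒≤ (threshold!< n 2≤n)) ⟩
    (e * V) ^ q * (n ^ (q ∸ p) * (b ^ s) ^ q)              ≡⟨ x∙yz≈xz∙y ((e * V) ^ q) (n ^ (q ∸ p)) ((b ^ s) ^ q) ⟩
    (e * V) ^ q * (b ^ s) ^ q * n ^ (q ∸ p)                ≡⟨ cong (_* n ^ (q ∸ p)) (^-distribʳ-* (e * V) (b ^ s) q) ⟨
    (e * V * b ^ s) ^ q * n ^ (q ∸ p)                      ≤⟨ *-monoˡ-≤ (n ^ (q ∸ p)) (^-monoˡ-≤ q (≤-trans (≤-reflexive (*-assoc e V (b ^ s))) (*-monoˡ-≤ (V * b ^ s) e≤w))) ⟩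
    (w * W s w) ^ q * n ^ (q ∸ p)                          ≤⟨ *-monoˡ-≤ (n ^ (q ∸ p)) (greatest-correct (fits? n) n (≤-trans 1≤e e≤w)) ⟩
    n ^ p * n ^ (q ∸ p)                                    ≡⟨ ^-distribˡ-+-* n p (q ∸ p) ⟨
    n ^ (p + (q ∸ p))                                      ≡⟨ cong (n ^_) (m+[n∸m]≡n (<⇒≤ p<q)) ⟩
    n ^ q                                                  ∎)
    where
    open ≤-Reasoning
    s = threshold n
    w = gap n
    L = s + w
    V = 8 ^ b * ((2 * a) ^ L * (s + w) ^ w)
    regroup : ∀ e g h f t → e * g * (h * (f * t)) ≡ e * (g * (h * t)) * f
    regroup = solve-∀

  threshold-slow : ∀ K c → 1 ≤ c → Eventually (λ n → K * c ^ threshold n ≤ n)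
  threshold-slow K c 1≤c with ^≤!-eventually (2 * c * b)
  ... | S₀ , [2cb]^s≤s! = 2 ⊔ K * c ^ S , bound
    where
    S = S₀ ⊔ K
    bound : ∀ n → 2 ⊔ K * c ^ S ≤ n → K * c ^ threshold n ≤ n
    bound n N≤n with S ≤? threshold n
    ... | no S≰t = ≤-trans (*-monoʳ-≤ K (^-monoʳ-≤ c {{>-nonZero 1≤c}} (<⇒≤ (≰⇒> S≰t)))) (m⊔n≤o⇒n≤o 2 (K * c ^ S) N≤n)
    ... | yes S≤t = <⇒≤ (*-cancelʳ-< (b ^ t) (K * c ^ t) n (begin-strict
      K * c ^ t * b ^ t          ≤⟨ *-monoˡ-≤ (b ^ t) (*-monoˡ-≤ (c ^ t) (<⇒≤ (≤-<-trans K≤t (n<2^n t)))) ⟩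
      2 ^ t * c ^ t * b ^ t      ≡⟨ cong (_* b ^ t) (^-distribʳ-* 2 c t) ⟨
      (2 * c) ^ t * b ^ t        ≡⟨ ^-distribʳ-* (2 * c) b t ⟨
      (2 * c * b) ^ t            ≤⟨ [2cb]^s≤s! t (≤-trans (m≤m⊔n S₀ K) S≤t) ⟩
      t !                        <⟨ threshold!<n*b^t n (m⊔n≤o⇒m≤o 2 (K * c ^ S) N≤n) ⟩
      n * b ^ t                  ∎))
      where
      open ≤-Reasoning
      t = threshold n
      K≤t : K ≤ t
      K≤t = ≤-trans (m≤n⊔m S₀ K) S≤t

  W≤ : ∀ s B → W s B ≤ 8 ^ b * ((2 * a) ^ B * (2 ^ B) ^ B) * (2 * a * 2 ^ B * b) ^ s
  W≤ s B = begin
    8 ^ b * ((2 * a) ^ (s + B) * (s + B) ^ B) * b ^ s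
      ≤⟨ *-monoˡ-≤ (b ^ s) (*-monoʳ-≤ (8 ^ b) (*-monoʳ-≤ ((2 * a) ^ (s + B)) (^-monoˡ-≤ B (<⇒≤ (n<2^n (s + B)))))) ⟩
    8 ^ b * ((2 * a) ^ (s + B) * (2 ^ (s + B)) ^ B) * b ^ s
      ≡⟨ cong₂ (λ u v → 8 ^ b * (u * v) * b ^ s) (^-distribˡ-+-* (2 * a) s B) 2^[s+B]^B≡ ⟩
    8 ^ b * ((2 * a) ^ s * (2 * a) ^ B * ((2 ^ B) ^ s * (2 ^ B) ^ B)) * b ^ s
      ≡⟨ regroup (8 ^ b) ((2 * a) ^ s) ((2 * a) ^ B) ((2 ^ B) ^ s) ((2 ^ B) ^ B) (b ^ s) ⟩
    8 ^ b * ((2 * a) ^ B * (2 ^ B) ^ B) * ((2 * a) ^ s * (2 ^ B) ^ s * b ^ s)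
      ≡⟨ cong (8 ^ b * ((2 * a) ^ B * (2 ^ B) ^ B) *_) (trans (^-distribʳ-* (2 * a * 2 ^ B) b s) (cong (_* b ^ s) (^-distribʳ-* (2 * a) (2 ^ B) s))) ⟨
    8 ^ b * ((2 * a) ^ B * (2 ^ B) ^ B) * (2 * a * 2 ^ B * b) ^ s ∎
    where
    open ≤-Reasoning
    2^[s+B]^B≡ : (2 ^ (s + B)) ^ B ≡ (2 ^ B) ^ s * (2 ^ B) ^ B
    2^[s+B]^B≡ = trans (cong (_^ B) (^-distribˡ-+-* 2 s B)) (trans (^-distribʳ-* (2 ^ s) (2 ^ B) B) (cong (_* (2 ^ B) ^ B) (^-comm 2 s B)))
    regroup : ∀ e as aB ts tB bs → e * (as * aB * (ts * tB)) * bs ≡ e * (aB * tB) * (as * ts * bs)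
    regroup = solve-∀

  gap→∞ : ∀ B → Eventually (λ n → B ≤ gap n)
  gap→∞ B = eventually-mono large (eventually-× (threshold-slow (F ^ q) (D ^ q) (1≤^ q 1≤D)) (B ⊔ 2 , λ n h → h))
    where
    C = 8 ^ b * ((2 * a) ^ B * (2 ^ B) ^ B)
    D = 2 * a * 2 ^ B * b
    F = B * C
    1≤D : 1 ≤ D
    1≤D = *-mono-≤ (*-mono-≤ (≤-trans 1≤a (m≤m+n a _)) (1≤^ B (s≤s z≤n))) 1≤b
    large : ∀ n → F ^ q * (D ^ q) ^ threshold n ≤ n × B ⊔ 2 ≤ n → B ≤ gap n
    large n (small , B⊔2≤n) = greatest-maximal (fits? n) n (m⊔n≤o⇒m≤o B 2 B⊔2≤n) (begin
      (B * W t B) ^ q          ≤⟨ ^-monoˡ-≤ q (≤-trans (*-monoʳ-≤ B (W≤ t B)) (≤-reflexive (sym (*-assoc B C (D ^ t))))) ⟩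
      (F * D ^ t) ^ q          ≡⟨ ^-distribʳ-* F (D ^ t) q ⟩
      F ^ q * (D ^ t) ^ q      ≡⟨ cong (F ^ q *_) (^-comm D t q) ⟩
      F ^ q * (D ^ q) ^ t      ≤⟨ small ⟩
      n                        ≤⟨ n≤n^p n 1≤p ⟩
      n ^ p                    ∎)
      where
      open ≤-Reasoning
      t = threshold n

lemma4p2 : (k t : ℕ → ℕ) →
    -- k and t positive integers (n ≥ 1 bins), with t ≤ n
    (∀ n → 1 ≤ n → 1 ≤ k n × 1 ≤ t n × t n ≤ n) →
    -- k = Θ(n): eventually n/a ≤ k(n) ≤ b·n for positive constants a, b
    (∃ λ a → ∃ λ b → 1 ≤ a × 1 ≤ b × Eventually (λ n → n ≤ a * k n × k n ≤ b * n)) →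
    -- t = o(n^(1-δ)) for some rational δ = p/q with 0 < δ < 1:
    -- for every m, eventually (m·t(n))^q ≤ n^(q-p)
    (∃ λ p → ∃ λ q → 1 ≤ p × p < q ×
       ((m : ℕ) → Eventually (λ n → (m * t n) ^ q ≤ n ^ (q ∸ p)))) →
    -- there is ω(n) → ∞ such that P(M - M_t ≥ ω(n)) → 1, i.e. the
    -- fraction of bad outcomes (among n^k equally likely) tends to 0
    ∃ λ (ω : ℕ → ℕ) →
      ((B : ℕ) → Eventually (λ n → B ≤ ω n)) ×
      ((m : ℕ) → Eventually (λ n → m * badCount n (k n) (t n) (ω n) ≤ n ^ k n))
lemma4p2 k t _ (a , b , 1≤a , 1≤b , k≍n) (p , q , 1≤p , p<q , t≪n) = gap , gap→∞ , few-bad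
  where
  open Choice a b p q 1≤a 1≤b 1≤p p<q
  few-bad : (m : ℕ) → Eventually (λ n → m * badCount n (k n) (t n) (gap n) ≤ n ^ k n)
  few-bad m = eventually-mono bound
    (eventually-× k≍n (eventually-× (t≪n (2 * suc m)) (eventually-× (gap→∞ (4 * suc m)) (eventually-× enough-eventually (2 , λ _ 2≤n → 2≤n)))))
    where
    bound : ∀ n → (n ≤ a * k n × k n ≤ b * n) × (2 * suc m * t n) ^ q ≤ n ^ (q ∸ p) × 4 * suc m ≤ gap n × Enough n (suc n) × 2 ≤ n →
            m * badCount n (k n) (t n) (gap n) ≤ n ^ k n
    bound 1 (_ , _ , _ , _ , s≤s ())
    bound n@(suc (suc y)) ((n≤ak , k≤bn) , t≤ , 4m≤gap , enough , 2≤n) =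
      ≤-trans (*-monoˡ-≤ (badCount n (k n) (t n) (gap n)) (n≤1+n m))
        (m*badCount≤ y (k n) (t n) (threshold n) (gap n) (suc m) a b (s≤s z≤n) 1≤a 1≤b k≤bn n≤ak
          (gap-fits n (4 * suc m) 2≤n (s≤s z≤n) 4m≤gap) (few-high-first-bins n (suc m) (t n) t≤ enough))
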